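{- Let $p \geq 1$, $n \geq 0$ and $A \geq 1$ be integers. Let $P \in \mathbb{Q}[X_1, \ldots, X_p]$ be a polynomial of degree $\leq A(n+1)-2$ with respect to each of the variables, such that for every $j \in \{1,\ldots,p\}$, $$P(X_1,\ldots, X_{j-1}, -X_j-n, X_{j+1}, \ldots, X_p) = (-1)^{A(n+1)+1} P(X_1,\ldots, X_p).$$ Then the multiple series $$\sum_{k_1, \ldots, k_p \geq 1} \frac{P(k_1, \ldots, k_p)}{(k_1)_{n+1}^{A} \cdots (k_p)_{n+1}^{A}}$$ equals a polynomial with rational coefficients, of degree at most $p$, in the numbers $\zeta(s)$ for $s$ odd integers with $3 \leq s \leq A$.
   Context: $(k)_\alpha = k(k+1)\cdots(k+\alpha-1)$ denotes the Pochhammer symbol. $\zeta(s) = \sum_{k \geq 1} k^{ -s}$ is the Riemann zeta function. The summation runs over all $p$-tuples of positive integers (independently). -}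

module Defs where

open import Data.Nat as ℕ using (ℕ; zero; suc)
open import Data.Integer as ℤ using (ℤ; +_)
open import Data.Rational using (ℚ; 0ℚ; 1ℚ; _+_; _*_; -_; _-_; _/_)
open import Data.Fin using (Fin; zero; suc; toℕ)
open import Data.Vec.Functional using (Vector; updateAt) renaming (_∷_ to _∷ᵥ_)
open import Data.List using (List; []; _∷_)
open import Data.Product using (_×_; _,_)
open import Relation.Binary.PropositionalEquality using (_≢_; _≡_)

ℕtoℚ : ℕ → ℚ
ℕtoℚ m = (+ m) / 1

_^ℚ_ : ℚ → ℕ → ℚ
x ^ℚ zero  = 1ℚ
x ^ℚ suc m = x * (x ^ℚ m)

-- Reciprocal of a natural number (1/m); only ever applied to m ≥ 1
-- (value at 0 is irrelevant and set to 0).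
invℕ : ℕ → ℚ
invℕ zero    = 0ℚ
invℕ (suc m) = (+ 1) / suc m

poch : ℕ → ℕ → ℕ
poch k zero    = 1
poch k (suc α) = k ℕ.* poch (suc k) α

sumFin : (p : ℕ) → (Fin p → ℕ) → ℕ
sumFin zero    f = 0
sumFin (suc p) f = f zero ℕ.+ sumFin p (λ i → f (suc i))

prodFinℚ : (p : ℕ) → (Fin p → ℚ) → ℚ
prodFinℚ zero    f = 1ℚ
prodFinℚ (suc p) f = f zero * prodFinℚ p (λ i → f (suc i))

Poly : ℕ → Set
Poly p = List (ℚ × (Fin p → ℕ))

evalPoly : {p : ℕ} → Poly p → (Fin p → ℚ) → ℚ
evalPoly []              x = 0ℚ
evalPoly ((c , e) ∷ ms) x = c * prodFinℚ _ (λ i → x i ^ℚ e i) + evalPoly ms x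

data AllMon {p : ℕ} (Q : (Fin p → ℕ) → Set) : Poly p → Set where
  []   : AllMon Q []
  _∷_  : ∀ {c e ms} → (c ≢ 0ℚ → Q e) → AllMon Q ms → AllMon Q ((c , e) ∷ ms)

rangeSum : ℕ → (ℕ → ℚ) → ℚ
rangeSum zero    g = 0ℚ
rangeSum (suc M) g = rangeSum M g + g (suc M)

boxSum : (p : ℕ) → ℕ → ((Fin p → ℕ) → ℚ) → ℚ
boxSum zero    M f = f (λ ())
boxSum (suc p) M f = rangeSum M (λ k → boxSum p M (λ v → f (k ∷ᵥ v)))

zetaTrunc : ℕ → ℕ → ℚ
zetaTrunc s M = rangeSum M (λ k → invℕ (k ℕ.^ s))

pochProd : (n A p : ℕ) → (Fin p → ℕ) → ℕ
pochProd n A zero    k = 1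
pochProd n A (suc p) k = (poch (k zero) (suc n) ℕ.^ A) ℕ.* pochProd n A p (λ i → k (suc i))

-- Square partial sum of the multiple series
-- Σ_{k ∈ {1..M}^p} P(k) / ((k_1)_{n+1}^A ... (k_p)_{n+1}^A)
seriesPartial : (p n A : ℕ) → Poly p → ℕ → ℚ
seriesPartial p n A P M =
  boxSum p M (λ k → evalPoly P (λ i → ℕtoℚ (k i))
                    * invℕ (pochProd n A p k))

signPow : ℕ → ℚ
signPow zero    = 1ℚ
signPow (suc m) = - signPow m

reflectAt : {p : ℕ} → ℕ → Fin p → (Fin p → ℚ) → (Fin p → ℚ)
reflectAt n j x = updateAt x j (λ y → - y - ℕtoℚ n)

-- Exponent vector of a monomial in variables Z_0, ..., Z_A (Z_s standing for ζ(s))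
-- that only involves Z_s with s odd, 3 ≤ s ≤ A, and has total degree ≤ p.
ZetaMonomial : (A p : ℕ) → (Fin (suc A) → ℕ) → Set
ZetaMonomial A p e =
  (∀ s → e s ≢ 0 → (3 ℕ.≤ toℕ s) × (toℕ s ℕ.% 2 ≡ 1)) × (sumFin (suc A) e ℕ.≤ p)

-- Put w(y) = 1 / (y)_{n+1}^A, so that the summand is P(k) ∏ⱼ w(kⱼ). Since w(−y−n) = (−1)^{A(n+1)} w(y),
-- the hypothesis makes P(x) ∏ⱼ w(xⱼ) change sign under each reflection xⱼ ↦ −xⱼ−n, so it equals its odd
-- part in every variable. Expanding P into monomials, the summand becomes a combination of products
-- ∏ⱼ oₑⱼ(kⱼ) of the one-variable functions oₑ(y) = (yᵉ w(y) − (−y−n)ᵉ w(−y−n)) / 2 with e ≤ A(n+1) − 2.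
-- Each oₑ is a sum of partial fractions c / (y+i)^s with 0 ≤ i ≤ n and 1 ≤ s ≤ A, and summing
-- c / (y+i)^s over 1 ≤ y ≤ M gives c ζ_M(s) plus a constant plus a tail tending to 0. The reflection
-- multiplies the coefficients of order s by (−1)^s, so in oₑ the total coefficient of each even order
-- vanishes, and the total coefficient of order 1 (the sum of the residues) vanishes because oₑ(y) = O(y⁻²).
-- Hence Σ_{y ≤ M} oₑ(y) is, up to o(1), a rational affine combination of the ζ_M(s) with s odd,
-- 3 ≤ s ≤ A, and the square partial sums of the multiple series are, up to o(1), a polynomial of
-- degree at most p in these.

module Submission where

open import Defs
open import Data.Nat as ℕ using (ℕ; zero; suc; _⊔_)
import Data.Nat.Properties as NP
import Data.Nat.Coprimality as Coprime
open import Data.Integer as ℤ using (ℤ)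
import Data.Integer.Properties as ZP
open import Data.Rational as Q using (ℚ; 0ℚ; 1ℚ; _+_; _*_; -_; _-_; _≤_; _<_; ∣_∣; mkℚ; toℚᵘ)
import Data.Rational.Properties as QP
import Data.Rational.Unnormalised as U
import Data.Rational.Unnormalised.Properties as UP
open import Data.Fin using (Fin; zero; suc; toℕ; fromℕ<)
import Data.Fin.Properties as FP
open import Data.Bool as Bool using (Bool; true; false; if_then_else_)
open import Data.Unit using (tt)
open import Data.Product using (Σ; ∃; _×_; _,_; proj₁; proj₂)
open import Data.Sum using (_⊎_; inj₁; inj₂)
open import Data.Empty using (⊥-elim)
open import Data.Maybe using (nothing)
open import Data.List using (List; []; _∷_; _++_; map; length; downFrom; tabulate)
open import Data.List.Properties using (length-++; length-downFrom)
open import Data.List.Relation.Unary.All as All using (All; []; _∷_)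
import Data.List.Relation.Unary.All.Properties as AllP
open import Data.Vec.Functional using () renaming (_∷_ to _∷ᵥ_)
import Data.Vec.Functional.Properties as VFP
open import Function using (_∘_)
open import Relation.Nullary using (Dec; yes; no; ¬_)
open import Relation.Nullary.Decidable using (dec-true; _×-dec_)
open import Relation.Nullary.Decidable.Core using (dec⇒maybe)
open import Relation.Binary using (tri<; tri≈; tri>)
open import Relation.Binary.PropositionalEquality
  using (_≡_; _≢_; refl; sym; trans; cong; cong₂; subst; subst₂; module ≡-Reasoning)
open import Algebra.Bundles using (CommutativeRing)
open import Algebra.Properties.Group QP.+-0-group using ()
  renaming (x∙y⁻¹≈ε⇒x≈y to p-q≡0⇒p≡q; ⁻¹-involutive to neg-involutive)
open import Algebra.Bundles using (CommutativeMonoid)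
open import Algebra.Properties.Ring (CommutativeRing.ring QP.+-*-commutativeRing) using (-1*x≈-x)
open import Algebra.Properties.CommutativeSemigroup NP.+-commutativeSemigroup using ()
  renaming (interchange to ℕ-+-interchange)
open import Algebra.Properties.CommutativeSemigroup (CommutativeMonoid.commutativeSemigroup QP.+-0-commutativeMonoid)
  using () renaming (interchange to +-interchange)
open import Algebra.Properties.CommutativeSemigroup (CommutativeMonoid.commutativeSemigroup QP.*-1-commutativeMonoid)
  using () renaming (interchange to *-interchange)
open import Algebra.Properties.Semiring.Sum (CommutativeRing.semiring QP.+-*-commutativeRing)
  using (sum; sum-cong-≗; sum-replicate-zero; ∑-distrib-+)
open import Tactic.RingSolver using (solve-∀)
open import Tactic.RingSolver.Core.AlmostCommutativeRing using (AlmostCommutativeRing; fromCommutativeRing)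
open import Level using (0ℓ)

ℤ-ring : AlmostCommutativeRing 0ℓ 0ℓ
ℤ-ring = fromCommutativeRing ZP.+-*-commutativeRing (λ _ → nothing)
ℚ-ring : AlmostCommutativeRing 0ℓ 0ℓ
ℚ-ring = fromCommutativeRing QP.+-*-commutativeRing (λ x → dec⇒maybe (0ℚ QP.≟ x))

-- A total inverse, with the junk value inv 0ℚ = 0ℚ.
inv : ℚ → ℚ
inv q with q QP.≟ 0ℚ
... | yes _ = 0ℚ
... | no q≢0 = Q.1/_ q {{Q.≢-nonZero q≢0}}

*-inv : ∀ q → q ≢ 0ℚ → q * inv q ≡ 1ℚ
*-inv q q≢0 with q QP.≟ 0ℚ
... | yes q≡0 = ⊥-elim (q≢0 q≡0)
... | no q≢0′ = QP.*-inverseʳ q {{Q.≢-nonZero q≢0′}}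

≡0⊎≢0 : ∀ a → a ≡ 0ℚ ⊎ a ≢ 0ℚ
≡0⊎≢0 a with a QP.≟ 0ℚ
... | yes a≡0 = inj₁ a≡0
... | no a≢0 = inj₂ a≢0

inv-unique : ∀ q r → q * r ≡ 1ℚ → inv q ≡ r
inv-unique q r qr≡1 = begin
    inv q              ≡⟨ sym (QP.*-identityʳ (inv q)) ⟩
    inv q * 1ℚ         ≡⟨ cong (inv q *_) (sym qr≡1) ⟩
    inv q * (q * r)    ≡⟨ sym (QP.*-assoc (inv q) q r) ⟩
    (inv q * q) * r    ≡⟨ cong (_* r) (trans (QP.*-comm (inv q) q) (*-inv q q≢0)) ⟩
    1ℚ * r             ≡⟨ QP.*-identityˡ r ⟩
    r ∎
  where
  open ≡-Reasoning
  q≢0 : q ≢ 0ℚ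
  q≢0 refl with trans (sym (QP.*-zeroˡ r)) qr≡1
  ... | ()

inv-1 : inv 1ℚ ≡ 1ℚ
inv-1 = inv-unique 1ℚ 1ℚ refl

inv-distrib-* : ∀ a b → inv (a * b) ≡ inv a * inv b
inv-distrib-* a b with ≡0⊎≢0 a | ≡0⊎≢0 b
... | inj₁ refl | _ = trans (cong inv (QP.*-zeroˡ b)) (sym (QP.*-zeroˡ (inv b)))
... | inj₂ _ | inj₁ refl = trans (cong inv (QP.*-zeroʳ a)) (sym (QP.*-zeroʳ (inv a)))
... | inj₂ a≢0 | inj₂ b≢0 = inv-unique (a * b) (inv a * inv b) (begin
    (a * b) * (inv a * inv b)  ≡⟨ *-interchange a b (inv a) (inv b) ⟩
    (a * inv a) * (b * inv b)  ≡⟨ cong₂ _*_ (*-inv a a≢0) (*-inv b b≢0) ⟩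
    1ℚ ∎)
  where open ≡-Reasoning

neg-*-neg : ∀ (a b : ℚ) → (- a) * (- b) ≡ a * b
neg-*-neg = solve-∀ ℚ-ring

inv-neg : ∀ a → inv (- a) ≡ - inv a
inv-neg a with ≡0⊎≢0 a
... | inj₁ refl = refl
... | inj₂ a≢0 = inv-unique (- a) (- inv a)
  (trans (neg-*-neg a (inv a)) (*-inv a a≢0))

inv-^ : ∀ x s → inv (x ^ℚ s) ≡ inv x ^ℚ s
inv-^ x zero    = inv-1
inv-^ x (suc s) = trans (inv-distrib-* x (x ^ℚ s)) (cong (inv x *_) (inv-^ x s))

^-distrib-* : ∀ a b s → (a * b) ^ℚ s ≡ (a ^ℚ s) * (b ^ℚ s)
^-distrib-* a b zero    = refl
^-distrib-* a b (suc s) =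
  trans (cong ((a * b) *_) (^-distrib-* a b s)) (*-interchange a b (a ^ℚ s) (b ^ℚ s))

^-+ : ∀ x a b → x ^ℚ (a ℕ.+ b) ≡ (x ^ℚ a) * (x ^ℚ b)
^-+ x zero    b = sym (QP.*-identityˡ _)
^-+ x (suc a) b = trans (cong (x *_) (^-+ x a b)) (sym (QP.*-assoc x _ _))

1^ : ∀ s → 1ℚ ^ℚ s ≡ 1ℚ
1^ zero    = refl
1^ (suc s) = trans (QP.*-identityˡ _) (1^ s)

ℕtoℚ-toℚᵘ : ∀ m → toℚᵘ (ℕtoℚ m) ≡ U.mkℚᵘ (ℤ.+ m) 0
ℕtoℚ-toℚᵘ m rewrite QP.normalize-coprime {m} {0} (Coprime.sym (Coprime.1-coprimeTo m)) = refl

ℕtoℚ-homo-+ : ∀ a b → ℕtoℚ (a ℕ.+ b) ≡ ℕtoℚ a + ℕtoℚ b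
ℕtoℚ-homo-+ a b = QP.toℚᵘ-injective (UP.≃-trans (UP.≃-reflexive (ℕtoℚ-toℚᵘ (a ℕ.+ b)))
   (UP.≃-trans (U.*≡* cross) (UP.≃-sym (UP.≃-trans (QP.toℚᵘ-homo-+ (ℕtoℚ a) (ℕtoℚ b))
       (UP.≃-reflexive (cong₂ U._+_ (ℕtoℚ-toℚᵘ a) (ℕtoℚ-toℚᵘ b)))))))
  where
  cross : ℤ.+ (a ℕ.+ b) ℤ.* ℤ.+ 1 ≡ (ℤ.+ a ℤ.* ℤ.+ 1 ℤ.+ ℤ.+ b ℤ.* ℤ.+ 1) ℤ.* ℤ.+ 1
  cross rewrite ZP.pos-+ a b = identity (ℤ.+ a) (ℤ.+ b)
    where
    identity : ∀ (x y : ℤ) → (x ℤ.+ y) ℤ.* ℤ.+ 1 ≡ (x ℤ.* ℤ.+ 1 ℤ.+ y ℤ.* ℤ.+ 1) ℤ.* ℤ.+ 1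
    identity = solve-∀ ℤ-ring

ℕtoℚ-homo-* : ∀ a b → ℕtoℚ (a ℕ.* b) ≡ ℕtoℚ a * ℕtoℚ b
ℕtoℚ-homo-* a b = QP.toℚᵘ-injective (UP.≃-trans (UP.≃-reflexive (ℕtoℚ-toℚᵘ (a ℕ.* b)))
   (UP.≃-trans (U.*≡* cross) (UP.≃-sym (UP.≃-trans (QP.toℚᵘ-homo-* (ℕtoℚ a) (ℕtoℚ b))
       (UP.≃-reflexive (cong₂ U._*_ (ℕtoℚ-toℚᵘ a) (ℕtoℚ-toℚᵘ b)))))))
  where
  cross : ℤ.+ (a ℕ.* b) ℤ.* (ℤ.+ 1 ℤ.* ℤ.+ 1) ≡ (ℤ.+ a ℤ.* ℤ.+ b) ℤ.* ℤ.+ 1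
  cross = trans (cong (ℤ._* (ℤ.+ 1 ℤ.* ℤ.+ 1)) (ZP.pos-* a b)) (identity (ℤ.+ a) (ℤ.+ b))
    where
    identity : ∀ (x y : ℤ) → (x ℤ.* y) ℤ.* (ℤ.+ 1 ℤ.* ℤ.+ 1) ≡ (x ℤ.* y) ℤ.* ℤ.+ 1
    identity = solve-∀ ℤ-ring

ℕtoℚ-homo-^ : ∀ k s → ℕtoℚ (k ℕ.^ s) ≡ ℕtoℚ k ^ℚ s
ℕtoℚ-homo-^ k zero    = refl
ℕtoℚ-homo-^ k (suc s) = trans (ℕtoℚ-homo-* k (k ℕ.^ s)) (cong (ℕtoℚ k *_) (ℕtoℚ-homo-^ k s))

ℕtoℚ-suc : ∀ m → ℕtoℚ (suc m) ≡ 1ℚ + ℕtoℚ m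
ℕtoℚ-suc = ℕtoℚ-homo-+ 1

ℕtoℚ-injective : ∀ a b → ℕtoℚ a ≡ ℕtoℚ b → a ≡ b
ℕtoℚ-injective a b e =
  ZP.+-injective (cong U.↥_ (trans (sym (ℕtoℚ-toℚᵘ a)) (trans (cong toℚᵘ e) (ℕtoℚ-toℚᵘ b))))

ℕtoℚ[1+m]≢0 : ∀ m → ℕtoℚ (suc m) ≢ 0ℚ
ℕtoℚ[1+m]≢0 m e with ℕtoℚ-injective (suc m) 0 e
... | ()

invℕ≡inv∘ℕtoℚ : ∀ m → invℕ m ≡ inv (ℕtoℚ m)
invℕ≡inv∘ℕtoℚ zero    = refl
invℕ≡inv∘ℕtoℚ (suc m) = sym (inv-unique (ℕtoℚ (suc m)) (invℕ (suc m)) product)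
  where
  invℕ-toℚᵘ : toℚᵘ (invℕ (suc m)) ≡ U.mkℚᵘ (ℤ.+ 1) m
  invℕ-toℚᵘ rewrite QP.normalize-coprime {1} {m} (Coprime.1-coprimeTo (suc m)) = refl
  identity : ∀ (x : ℤ) → (x ℤ.* ℤ.+ 1) ℤ.* ℤ.+ 1 ≡ ℤ.+ 1 ℤ.* (ℤ.+ 1 ℤ.* x)
  identity = solve-∀ ℤ-ring
  product : ℕtoℚ (suc m) * invℕ (suc m) ≡ 1ℚ
  product = QP.toℚᵘ-injective (UP.≃-trans (QP.toℚᵘ-homo-* (ℕtoℚ (suc m)) (invℕ (suc m)))
    (UP.≃-trans (UP.≃-reflexive (cong₂ U._*_ (ℕtoℚ-toℚᵘ (suc m)) invℕ-toℚᵘ))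
      (U.*≡* (identity (ℤ.+ (suc m))))))

invℕ-^ : ∀ k s → invℕ (k ℕ.^ s) ≡ inv (ℕtoℚ k) ^ℚ s
invℕ-^ k s = trans (invℕ≡inv∘ℕtoℚ (k ℕ.^ s)) (trans (cong inv (ℕtoℚ-homo-^ k s)) (inv-^ (ℕtoℚ k) s))

invℕ-distrib-* : ∀ a b → invℕ (a ℕ.* b) ≡ invℕ a * invℕ b
invℕ-distrib-* a b = begin
  invℕ (a ℕ.* b)               ≡⟨ invℕ≡inv∘ℕtoℚ (a ℕ.* b) ⟩
  inv (ℕtoℚ (a ℕ.* b))         ≡⟨ cong inv (ℕtoℚ-homo-* a b) ⟩
  inv (ℕtoℚ a * ℕtoℚ b)        ≡⟨ inv-distrib-* (ℕtoℚ a) (ℕtoℚ b) ⟩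
  inv (ℕtoℚ a) * inv (ℕtoℚ b)  ≡⟨ sym (cong₂ _*_ (invℕ≡inv∘ℕtoℚ a) (invℕ≡inv∘ℕtoℚ b)) ⟩
  invℕ a * invℕ b ∎
  where open ≡-Reasoning

-- Partial fractions in one variable

record Fraction : Set where
  constructor frac
  field
    coeff : ℚ
    pole  : ℕ
    order : ℕ
open Fraction

evalFraction : ℚ → Fraction → ℚ
evalFraction x f = coeff f * (inv (x + ℕtoℚ (pole f)) ^ℚ order f)

PartialFractions : Set
PartialFractions = List Fraction

evalPF : ℚ → PartialFractions → ℚ
evalPF x []      = 0ℚ
evalPF x (f ∷ T) = evalFraction x f + evalPF x T

evalPF-++ : ∀ x T U → evalPF x (T ++ U) ≡ evalPF x T + evalPF x U
evalPF-++ x []      U = sym (QP.+-identityˡ _)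
evalPF-++ x (f ∷ T) U = trans (cong (evalFraction x f +_) (evalPF-++ x T U)) (sym (QP.+-assoc (evalFraction x f) _ _))

scalePF : ℚ → PartialFractions → PartialFractions
scalePF a = map λ f → record f { coeff = a * coeff f }

evalPF-scale : ∀ x a T → evalPF x (scalePF a T) ≡ a * evalPF x T
evalPF-scale x a []      = sym (QP.*-zeroʳ a)
evalPF-scale x a (f ∷ T) =
  trans (cong₂ _+_ (QP.*-assoc a (coeff f) _) (evalPF-scale x a T)) (sym (QP.*-distribˡ-+ a _ _))

inv-product-split : ∀ x i j → i ≢ j → x + ℕtoℚ i ≢ 0ℚ → x + ℕtoℚ j ≢ 0ℚ →
  inv (x + ℕtoℚ i) * inv (x + ℕtoℚ j) ≡ inv (ℕtoℚ j - ℕtoℚ i) * (inv (x + ℕtoℚ i) - inv (x + ℕtoℚ j))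
inv-product-split x i j i≢j xi≢0 xj≢0 = begin
    u * v                   ≡⟨ sym (QP.*-identityˡ (u * v)) ⟩
    1ℚ * (u * v)            ≡⟨ cong (_* (u * v)) (sym (*-inv δ δ≢0)) ⟩
    (δ * inv δ) * (u * v)   ≡⟨ reassoc (inv δ) δ (u * v) ⟩
    inv δ * (δ * (u * v))   ≡⟨ cong (inv δ *_) δuv≡u-v ⟩
    inv δ * (u - v) ∎
  where
  open ≡-Reasoning
  u = inv (x + ℕtoℚ i)
  v = inv (x + ℕtoℚ j)
  δ = ℕtoℚ j - ℕtoℚ i
  reassoc : ∀ (d δ w : ℚ) → (δ * d) * w ≡ d * (δ * w)
  reassoc = solve-∀ ℚ-ring
  δ≢0 : δ ≢ 0ℚ
  δ≢0 δ≡0 = i≢j (sym (ℕtoℚ-injective j i (p-q≡0⇒p≡q _ _ δ≡0)))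
  expand : ∀ (x i j u v : ℚ) → (j - i) * (u * v) ≡ u * (v * (x + j)) - v * (u * (x + i))
  expand = solve-∀ ℚ-ring
  δuv≡u-v : δ * (u * v) ≡ u - v
  δuv≡u-v = begin
    δ * (u * v)                                   ≡⟨ expand x (ℕtoℚ i) (ℕtoℚ j) u v ⟩
    u * (v * (x + ℕtoℚ j)) - v * (u * (x + ℕtoℚ i)) ≡⟨ cong₂ (λ a b → u * a - v * b) (vx≡1 j xj≢0) (vx≡1 i xi≢0) ⟩
    u * 1ℚ - v * 1ℚ                               ≡⟨ cong₂ _-_ (QP.*-identityʳ u) (QP.*-identityʳ v) ⟩
    u - v ∎
    where
    vx≡1 : ∀ k → x + ℕtoℚ k ≢ 0ℚ → inv (x + ℕtoℚ k) * (x + ℕtoℚ k) ≡ 1ℚ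
    vx≡1 k ne = trans (QP.*-comm (inv (x + ℕtoℚ k)) _) (*-inv _ ne)

overDistinct : ℕ → ℕ → ℕ → ℚ → PartialFractions
overDistinct j i zero    c = frac c j 1 ∷ []
overDistinct j i (suc s) c =
  frac (c * inv (ℕtoℚ j - ℕtoℚ i)) i (suc s) ∷ overDistinct j i s (- (c * inv (ℕtoℚ j - ℕtoℚ i)))

overDistinct-correct : ∀ x j i s c → i ≢ j → x + ℕtoℚ i ≢ 0ℚ → x + ℕtoℚ j ≢ 0ℚ →
  evalPF x (overDistinct j i s c) ≡ c * (inv (x + ℕtoℚ i) ^ℚ s) * inv (x + ℕtoℚ j)
overDistinct-correct x j i zero    c _ _ _ = base c (inv (x + ℕtoℚ j))
  where
  base : ∀ (c v : ℚ) → c * (v * 1ℚ) + 0ℚ ≡ c * 1ℚ * v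
  base = solve-∀ ℚ-ring
overDistinct-correct x j i (suc s) c i≢j xi≢0 xj≢0 = begin
    (c * d) * (u * w) + evalPF x (overDistinct j i s (- (c * d)))
      ≡⟨ cong ((c * d) * (u * w) +_) (overDistinct-correct x j i s (- (c * d)) i≢j xi≢0 xj≢0) ⟩
    (c * d) * (u * w) + (- (c * d)) * w * v
      ≡⟨ collect c d u v w ⟩
    c * w * (d * (u - v))
      ≡⟨ cong (c * w *_) (sym (inv-product-split x i j i≢j xi≢0 xj≢0)) ⟩
    c * w * (u * v)
      ≡⟨ reorder c u v w ⟩
    c * (u * w) * v ∎
  where
  open ≡-Reasoning
  d = inv (ℕtoℚ j - ℕtoℚ i)
  u = inv (x + ℕtoℚ i)
  v = inv (x + ℕtoℚ j)
  w = u ^ℚ s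
  collect : ∀ (c d u v w : ℚ) → (c * d) * (u * w) + (- (c * d)) * w * v ≡ c * w * (d * (u - v))
  collect = solve-∀ ℚ-ring
  reorder : ∀ (c u v w : ℚ) → c * w * (u * v) ≡ c * (u * w) * v
  reorder = solve-∀ ℚ-ring

divFraction : ℕ → Fraction → PartialFractions
divFraction j (frac c i s) with i ℕ.≟ j
... | yes _ = frac c i (suc s) ∷ []
... | no  _ = overDistinct j i s c

divPF : ℕ → PartialFractions → PartialFractions
divPF j []      = []
divPF j (f ∷ T) = divFraction j f ++ divPF j T

AvoidsPoles : ℕ → ℚ → Set
AvoidsPoles n x = ∀ i → i ℕ.≤ n → x + ℕtoℚ i ≢ 0ℚ

PolesBelow : ℕ → PartialFractions → Set
PolesBelow n = All ((ℕ._≤ n) ∘ pole)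

divFraction-correct : ∀ {n} x j f → AvoidsPoles n x → pole f ℕ.≤ n → j ℕ.≤ n →
  evalPF x (divFraction j f) ≡ evalFraction x f * inv (x + ℕtoℚ j)
divFraction-correct x j (frac c i s) avoid i≤n j≤n with i ℕ.≟ j
... | yes refl = shift c (inv (x + ℕtoℚ i)) (inv (x + ℕtoℚ i) ^ℚ s)
  where
  shift : ∀ (c u w : ℚ) → c * (u * w) + 0ℚ ≡ c * w * u
  shift = solve-∀ ℚ-ring
... | no i≢j = overDistinct-correct x j i s c i≢j (avoid i i≤n) (avoid j j≤n)

divPF-correct : ∀ {n} x j T → AvoidsPoles n x → PolesBelow n T → j ℕ.≤ n →
  evalPF x (divPF j T) ≡ evalPF x T * inv (x + ℕtoℚ j)
divPF-correct x j []      avoid []          j≤n = sym (QP.*-zeroˡ (inv (x + ℕtoℚ j)))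
divPF-correct x j (f ∷ T) avoid (f≤n ∷ T≤n) j≤n = begin
  evalPF x (divFraction j f ++ divPF j T)           ≡⟨ evalPF-++ x (divFraction j f) (divPF j T) ⟩
  evalPF x (divFraction j f) + evalPF x (divPF j T) ≡⟨ cong₂ _+_ (divFraction-correct x j f avoid f≤n j≤n)
                                                                  (divPF-correct x j T avoid T≤n j≤n) ⟩
  evalFraction x f * v + evalPF x T * v             ≡⟨ sym (QP.*-distribʳ-+ v (evalFraction x f) _) ⟩
  (evalFraction x f + evalPF x T) * v ∎
  where
  open ≡-Reasoning
  v = inv (x + ℕtoℚ j)

multiplicity : ℕ → List ℕ → ℕ
multiplicity i []      = 0
multiplicity i (j ∷ L) = if i ℕ.≡ᵇ j then suc (multiplicity i L) else multiplicity i L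

multiplicity-here : ∀ j L → multiplicity j (j ∷ L) ≡ suc (multiplicity j L)
multiplicity-here j L rewrite dec-true (j ℕ.≟ j) refl = refl

multiplicity-there : ∀ i j L → multiplicity i L ℕ.≤ multiplicity i (j ∷ L)
multiplicity-there i j L with i ℕ.≡ᵇ j
... | true  = NP.n≤1+n _
... | false = NP.≤-refl

Admissible : ℕ → List ℕ → Fraction → Set
Admissible n L f = (pole f ℕ.≤ n) × (order f ℕ.≤ multiplicity (pole f) L)

NoPolynomialPart : PartialFractions → Set
NoPolynomialPart = All ((1 ℕ.≤_) ∘ order)

scalePF-All : ∀ {P : Fraction → Set} a {T} → (∀ {f} → P f → P (record f { coeff = a * coeff f })) →
  All P T → All P (scalePF a T)
scalePF-All a keep T = AllP.map⁺ (All.map keep T)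

overDistinct-admissible : ∀ {n} L {j i} s c → j ℕ.≤ n → i ℕ.≤ n → s ℕ.≤ multiplicity i (j ∷ L) →
  All (Admissible n (j ∷ L)) (overDistinct j i s c)
overDistinct-admissible L {j} zero c j≤n i≤n _ =
  (j≤n , subst (1 ℕ.≤_) (sym (multiplicity-here j L)) (ℕ.s≤s ℕ.z≤n)) ∷ []
overDistinct-admissible L (suc s) c j≤n i≤n s<m =
  (i≤n , s<m) ∷ overDistinct-admissible L s _ j≤n i≤n (NP.<⇒≤ s<m)

divFraction-admissible : ∀ {n} L j f → j ℕ.≤ n → Admissible n L f → All (Admissible n (j ∷ L)) (divFraction j f)
divFraction-admissible L j (frac c i s) j≤n (i≤n , s≤m) with i ℕ.≟ j
... | yes refl = (i≤n , subst (suc s ℕ.≤_) (sym (multiplicity-here i L)) (ℕ.s≤s s≤m)) ∷ []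
... | no  _    = overDistinct-admissible L s c j≤n i≤n (NP.≤-trans s≤m (multiplicity-there i j L))

divPF-admissible : ∀ {n} L j T → j ℕ.≤ n → All (Admissible n L) T → All (Admissible n (j ∷ L)) (divPF j T)
divPF-admissible L j []      j≤n []       = []
divPF-admissible L j (f ∷ T) j≤n (af ∷ aT) =
  AllP.++⁺ (divFraction-admissible L j f j≤n af) (divPF-admissible L j T j≤n aT)

divPF-noPolynomialPart : ∀ j T → NoPolynomialPart (divPF j T)
divPF-noPolynomialPart j []      = []
divPF-noPolynomialPart j (f ∷ T) = AllP.++⁺ (divFraction-pos f) (divPF-noPolynomialPart j T)
  where
  overDistinct-pos : ∀ i s c → NoPolynomialPart (overDistinct j i s c)
  overDistinct-pos i zero    c = ℕ.s≤s ℕ.z≤n ∷ []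
  overDistinct-pos i (suc s) c = ℕ.s≤s ℕ.z≤n ∷ overDistinct-pos i s _
  divFraction-pos : ∀ f → NoPolynomialPart (divFraction j f)
  divFraction-pos (frac c i s) with i ℕ.≟ j
  ... | yes _ = ℕ.s≤s ℕ.z≤n ∷ []
  ... | no  _ = overDistinct-pos i s c

-- monomialOver L e expands x ^ e / ∏_{j ∈ L} (x + j), meaningful for e ≤ length L, through
-- x ^ (e + 1) / ((x + j) D) = x ^ e / D − j x ^ e / ((x + j) D).
monomialOver : List ℕ → ℕ → PartialFractions
monomialOver []      e       = frac 1ℚ 0 0 ∷ []
monomialOver (j ∷ L) zero    = divPF j (monomialOver L zero)
monomialOver (j ∷ L) (suc e) = monomialOver L e ++ scalePF (- ℕtoℚ j) (divPF j (monomialOver L e))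

monomialOver-admissible : ∀ {n} L e → All (ℕ._≤ n) L → All (Admissible n L) (monomialOver L e)
monomialOver-admissible []      e       []          = (ℕ.z≤n , ℕ.z≤n) ∷ []
monomialOver-admissible (j ∷ L) zero    (j≤n ∷ L≤n) =
  divPF-admissible L j (monomialOver L zero) j≤n (monomialOver-admissible L zero L≤n)
monomialOver-admissible (j ∷ L) (suc e) (j≤n ∷ L≤n) = AllP.++⁺
  (All.map (λ { {f} (i≤n , s≤m) → i≤n , NP.≤-trans s≤m (multiplicity-there (pole f) j L) })
           (monomialOver-admissible L e L≤n))
  (scalePF-All (- ℕtoℚ j) (λ a → a) (divPF-admissible L j (monomialOver L e) j≤n (monomialOver-admissible L e L≤n)))

monomialOver-noPolynomialPart : ∀ L e → e ℕ.< length L → NoPolynomialPart (monomialOver L e)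
monomialOver-noPolynomialPart (j ∷ L) zero    _           = divPF-noPolynomialPart j (monomialOver L zero)
monomialOver-noPolynomialPart (j ∷ L) (suc e) (ℕ.s≤s e<L) = AllP.++⁺
  (monomialOver-noPolynomialPart L e e<L) (scalePF-All (- ℕtoℚ j) (λ a → a) (divPF-noPolynomialPart j (monomialOver L e)))

invProduct : ℚ → List ℕ → ℚ
invProduct x []      = 1ℚ
invProduct x (j ∷ L) = inv (x + ℕtoℚ j) * invProduct x L

monomialOver-correct : ∀ {n} x L e → AvoidsPoles n x → All (ℕ._≤ n) L → e ℕ.≤ length L →
  evalPF x (monomialOver L e) ≡ (x ^ℚ e) * invProduct x L
monomialOver-correct x []      zero    avoid _           _ = refl
monomialOver-correct x (j ∷ L) zero    avoid (j≤n ∷ L≤n) _ = begin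
  evalPF x (divPF j (monomialOver L zero))     ≡⟨ divPF-correct x j _ avoid poles j≤n ⟩
  evalPF x (monomialOver L zero) * v           ≡⟨ cong (_* v) (monomialOver-correct x L zero avoid L≤n ℕ.z≤n) ⟩
  1ℚ * invProduct x L * v                      ≡⟨ reorder (invProduct x L) v ⟩
  1ℚ * (v * invProduct x L) ∎
  where
  open ≡-Reasoning
  v = inv (x + ℕtoℚ j)
  poles : PolesBelow _ (monomialOver L zero)
  poles = All.map proj₁ (monomialOver-admissible L zero L≤n)
  reorder : ∀ (P v : ℚ) → 1ℚ * P * v ≡ 1ℚ * (v * P)
  reorder = solve-∀ ℚ-ring
monomialOver-correct x (j ∷ L) (suc e) avoid (j≤n ∷ L≤n) (ℕ.s≤s e≤L) = begin
    evalPF x (monomialOver L e ++ scalePF (- ℕtoℚ j) (divPF j (monomialOver L e)))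
      ≡⟨ evalPF-++ x (monomialOver L e) _ ⟩
    E + evalPF x (scalePF (- ℕtoℚ j) (divPF j (monomialOver L e)))
      ≡⟨ cong (E +_) (evalPF-scale x (- ℕtoℚ j) (divPF j (monomialOver L e))) ⟩
    E + (- ℕtoℚ j) * evalPF x (divPF j (monomialOver L e))
      ≡⟨ cong (λ r → E + (- ℕtoℚ j) * r) (divPF-correct x j _ avoid poles j≤n) ⟩
    E + (- ℕtoℚ j) * (E * v)
      ≡⟨ cong (λ r → r + (- ℕtoℚ j) * (E * v)) (sym (QP.*-identityʳ E)) ⟩
    E * 1ℚ + (- ℕtoℚ j) * (E * v)
      ≡⟨ cong (λ o → E * o + (- ℕtoℚ j) * (E * v)) (sym (*-inv (x + ℕtoℚ j) (avoid j j≤n))) ⟩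
    E * ((x + ℕtoℚ j) * v) + (- ℕtoℚ j) * (E * v)
      ≡⟨ cong (λ E′ → E′ * ((x + ℕtoℚ j) * v) + (- ℕtoℚ j) * (E′ * v)) (monomialOver-correct x L e avoid L≤n e≤L) ⟩
    ((x ^ℚ e) * invProduct x L) * ((x + ℕtoℚ j) * v) + (- ℕtoℚ j) * (((x ^ℚ e) * invProduct x L) * v)
      ≡⟨ cancel (x ^ℚ e) (invProduct x L) v (ℕtoℚ j) x ⟩
    (x * (x ^ℚ e)) * (v * invProduct x L) ∎
  where
  open ≡-Reasoning
  E = evalPF x (monomialOver L e)
  v = inv (x + ℕtoℚ j)
  poles : PolesBelow _ (monomialOver L e)
  poles = All.map proj₁ (monomialOver-admissible L e L≤n)
  cancel : ∀ (xe P v j x : ℚ) → (xe * P) * ((x + j) * v) + (- j) * ((xe * P) * v) ≡ (x * xe) * (v * P)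
  cancel = solve-∀ ℚ-ring

coeffOfOrder : ℕ → Fraction → ℚ
coeffOfOrder s f = if s ℕ.≡ᵇ order f then coeff f else 0ℚ

totalCoeff : ℕ → PartialFractions → ℚ
totalCoeff s []      = 0ℚ
totalCoeff s (f ∷ T) = coeffOfOrder s f + totalCoeff s T

totalCoeff-++ : ∀ s T U → totalCoeff s (T ++ U) ≡ totalCoeff s T + totalCoeff s U
totalCoeff-++ s []      U = sym (QP.+-identityˡ _)
totalCoeff-++ s (f ∷ T) U =
  trans (cong (coeffOfOrder s f +_) (totalCoeff-++ s T U)) (sym (QP.+-assoc (coeffOfOrder s f) _ _))

totalCoeff-scale : ∀ s a T → totalCoeff s (scalePF a T) ≡ a * totalCoeff s T
totalCoeff-scale s a []      = sym (QP.*-zeroʳ a)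
totalCoeff-scale s a (f ∷ T) =
  trans (cong₂ _+_ (coeffOfOrder-scale f) (totalCoeff-scale s a T)) (sym (QP.*-distribˡ-+ a _ _))
  where
  coeffOfOrder-scale : ∀ f → coeffOfOrder s (record f { coeff = a * coeff f }) ≡ a * coeffOfOrder s f
  coeffOfOrder-scale f with s ℕ.≡ᵇ order f
  ... | true  = refl
  ... | false = sym (QP.*-zeroʳ a)

totalCoeff-0-noPolynomialPart : ∀ T → NoPolynomialPart T → totalCoeff 0 T ≡ 0ℚ
totalCoeff-0-noPolynomialPart []                    []        = refl
totalCoeff-0-noPolynomialPart (frac c i (suc s) ∷ T) (_ ∷ pos) = trans (QP.+-identityˡ _) (totalCoeff-0-noPolynomialPart T pos)

totalCoeff-1-divPF : ∀ j T → totalCoeff 1 (divPF j T) ≡ totalCoeff 0 T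
totalCoeff-1-divPF j []      = refl
totalCoeff-1-divPF j (f ∷ T) =
  trans (totalCoeff-++ 1 (divFraction j f) (divPF j T)) (cong₂ _+_ (divFraction-1 f) (totalCoeff-1-divPF j T))
  where
  overDistinct-1 : ∀ i s c → totalCoeff 1 (overDistinct j i s c) ≡ coeffOfOrder 0 (frac c i s)
  overDistinct-1 i zero          c = QP.+-identityʳ c
  overDistinct-1 i (suc zero)    c =
    trans (cong (cd +_) (overDistinct-1 i zero (- cd))) (QP.+-inverseʳ cd)
    where cd = c * inv (ℕtoℚ j - ℕtoℚ i)
  overDistinct-1 i (suc (suc s)) c =
    trans (QP.+-identityˡ _) (overDistinct-1 i (suc s) (- (c * inv (ℕtoℚ j - ℕtoℚ i))))
  divFraction-1 : ∀ f → totalCoeff 1 (divFraction j f) ≡ coeffOfOrder 0 f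
  divFraction-1 (frac c i s) with i ℕ.≟ j
  divFraction-1 (frac c i zero)    | yes _ = QP.+-identityʳ c
  divFraction-1 (frac c i (suc s)) | yes _ = refl
  ... | no _ = overDistinct-1 i s c

-- x ^ e / ∏_{j ∈ L} (x + j) decays like x ^ (e − length L) at infinity, so the total coefficient of
-- its simple poles (the sum of its residues) vanishes as soon as e + 2 ≤ length L.
monomialOver-totalCoeff-1 : ∀ L e → suc e ℕ.< length L → totalCoeff 1 (monomialOver L e) ≡ 0ℚ
monomialOver-totalCoeff-1 (j ∷ L) zero (ℕ.s≤s 1<L) =
  trans (totalCoeff-1-divPF j (monomialOver L zero))
        (totalCoeff-0-noPolynomialPart _ (monomialOver-noPolynomialPart L zero 1<L))
monomialOver-totalCoeff-1 (j ∷ L) (suc e) (ℕ.s≤s e+2<L) = begin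
  totalCoeff 1 (monomialOver L e ++ scalePF (- ℕtoℚ j) (divPF j (monomialOver L e)))
    ≡⟨ totalCoeff-++ 1 (monomialOver L e) _ ⟩
  totalCoeff 1 (monomialOver L e) + totalCoeff 1 (scalePF (- ℕtoℚ j) (divPF j (monomialOver L e)))
    ≡⟨ cong₂ _+_ (monomialOver-totalCoeff-1 L e e+2<L) (totalCoeff-scale 1 (- ℕtoℚ j) (divPF j (monomialOver L e))) ⟩
  0ℚ + (- ℕtoℚ j) * totalCoeff 1 (divPF j (monomialOver L e))
    ≡⟨ cong (λ t → 0ℚ + (- ℕtoℚ j) * t) (totalCoeff-1-divPF j (monomialOver L e)) ⟩
  0ℚ + (- ℕtoℚ j) * totalCoeff 0 (monomialOver L e)
    ≡⟨ cong (λ t → 0ℚ + (- ℕtoℚ j) * t)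
         (totalCoeff-0-noPolynomialPart _ (monomialOver-noPolynomialPart L e (NP.<-trans (NP.n<1+n e) e+2<L))) ⟩
  0ℚ + (- ℕtoℚ j) * 0ℚ
    ≡⟨ cong (0ℚ +_) (QP.*-zeroʳ (- ℕtoℚ j)) ⟩
  0ℚ ∎
  where open ≡-Reasoning

-- The reflection y ↦ −y − n

neg-^ : ∀ w s → (- w) ^ℚ s ≡ signPow s * (w ^ℚ s)
neg-^ w zero    = refl
neg-^ w (suc s) = trans (cong ((- w) *_) (neg-^ w s)) (swap w (signPow s) (w ^ℚ s))
  where
  swap : ∀ (w σ p : ℚ) → (- w) * (σ * p) ≡ (- σ) * (w * p)
  swap = solve-∀ ℚ-ring

signPow-+ : ∀ a b → signPow (a ℕ.+ b) ≡ signPow a * signPow b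
signPow-+ zero    b = sym (QP.*-identityˡ _)
signPow-+ (suc a) b = trans (cong -_ (signPow-+ a b)) (QP.neg-distribˡ-* (signPow a) (signPow b))

signPow-^ : ∀ m A → signPow m ^ℚ A ≡ signPow (A ℕ.* m)
signPow-^ m zero    = refl
signPow-^ m (suc A) = trans (cong (signPow m *_) (signPow-^ m A)) (sym (signPow-+ m (A ℕ.* m)))

signPow-square : ∀ m → signPow m * signPow m ≡ 1ℚ
signPow-square zero    = refl
signPow-square (suc m) = trans (neg-*-neg (signPow m) (signPow m)) (signPow-square m)

signPow-even : ∀ s → s ℕ.% 2 ≢ 1 → signPow s ≡ 1ℚ
signPow-even zero          _    = refl
signPow-even (suc zero)    odd≢ = ⊥-elim (odd≢ refl)
signPow-even (suc (suc s)) odd≢ = trans (neg-involutive (signPow s)) (signPow-even s odd≢)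

reflect-shift : ∀ x n i → i ℕ.≤ n → (- x - ℕtoℚ n) + ℕtoℚ i ≡ - (x + ℕtoℚ (n ℕ.∸ i))
reflect-shift x n i i≤n = begin
  (- x - ℕtoℚ n) + ℕtoℚ i                           ≡⟨ cong (λ r → - x - r + ℕtoℚ i) n≡n-i+i ⟩
  (- x - (ℕtoℚ (n ℕ.∸ i) + ℕtoℚ i)) + ℕtoℚ i       ≡⟨ cancel x (ℕtoℚ (n ℕ.∸ i)) (ℕtoℚ i) ⟩
  - (x + ℕtoℚ (n ℕ.∸ i)) ∎
  where
  open ≡-Reasoning
  n≡n-i+i : ℕtoℚ n ≡ ℕtoℚ (n ℕ.∸ i) + ℕtoℚ i
  n≡n-i+i = trans (cong ℕtoℚ (sym (NP.m∸n+n≡m i≤n))) (ℕtoℚ-homo-+ (n ℕ.∸ i) i)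
  cancel : ∀ (x a b : ℚ) → - x - (a + b) + b ≡ - (x + a)
  cancel = solve-∀ ℚ-ring

AvoidsPoles-reflect : ∀ n x → AvoidsPoles n x → AvoidsPoles n (- x - ℕtoℚ n)
AvoidsPoles-reflect n x avoid i i≤n y+i≡0 = avoid (n ℕ.∸ i) (NP.m∸n≤m n i)
  (QP.neg-injective (trans (sym (reflect-shift x n i i≤n)) y+i≡0))

reflectPF : ℕ → PartialFractions → PartialFractions
reflectPF n = map λ f → frac (signPow (order f) * coeff f) (n ℕ.∸ pole f) (order f)

evalPF-reflect : ∀ x n T → PolesBelow n T → evalPF x (reflectPF n T) ≡ evalPF (- x - ℕtoℚ n) T
evalPF-reflect x n []               []          = refl
evalPF-reflect x n (frac c i s ∷ T) (i≤n ∷ T≤n) = cong₂ _+_ fraction (evalPF-reflect x n T T≤n)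
  where
  open ≡-Reasoning
  w = inv (x + ℕtoℚ (n ℕ.∸ i))
  reorder : ∀ (σ c w : ℚ) → σ * c * w ≡ c * (σ * w)
  reorder = solve-∀ ℚ-ring
  fraction : signPow s * c * (w ^ℚ s) ≡ c * (inv (- x - ℕtoℚ n + ℕtoℚ i) ^ℚ s)
  fraction = begin
    signPow s * c * (w ^ℚ s)                    ≡⟨ reorder (signPow s) c (w ^ℚ s) ⟩
    c * (signPow s * (w ^ℚ s))                  ≡⟨ cong (c *_) (sym (neg-^ w s)) ⟩
    c * ((- w) ^ℚ s)                            ≡⟨ cong (λ r → c * (r ^ℚ s)) (sym (inv-neg (x + ℕtoℚ (n ℕ.∸ i)))) ⟩
    c * (inv (- (x + ℕtoℚ (n ℕ.∸ i))) ^ℚ s)     ≡⟨ cong (λ r → c * (inv r ^ℚ s)) (sym (reflect-shift x n i i≤n)) ⟩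
    c * (inv (- x - ℕtoℚ n + ℕtoℚ i) ^ℚ s) ∎

totalCoeff-reflect : ∀ s n T → totalCoeff s (reflectPF n T) ≡ signPow s * totalCoeff s T
totalCoeff-reflect s n []      = sym (QP.*-zeroʳ (signPow s))
totalCoeff-reflect s n (f ∷ T) =
  trans (cong₂ _+_ coeffOfOrder-reflect (totalCoeff-reflect s n T)) (sym (QP.*-distribˡ-+ (signPow s) _ _))
  where
  coeffOfOrder-reflect : coeffOfOrder s (frac (signPow (order f) * coeff f) (n ℕ.∸ pole f) (order f))
                       ≡ signPow s * coeffOfOrder s f
  coeffOfOrder-reflect with s ℕ.≡ᵇ order f in eq
  ... | true rewrite NP.≡ᵇ⇒≡ s (order f) (subst Bool.T (sym eq) tt) = refl
  ... | false = sym (QP.*-zeroʳ (signPow s))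

antisymmetrise : ℕ → PartialFractions → PartialFractions
antisymmetrise n T = scalePF Q.½ (T ++ scalePF (- 1ℚ) (reflectPF n T))

antisymmetrise-All : ∀ {Q : ℕ → ℕ → Set} n T → (∀ {i s} → Q i s → Q (n ℕ.∸ i) s) →
  All (λ f → Q (pole f) (order f)) T → All (λ f → Q (pole f) (order f)) (antisymmetrise n T)
antisymmetrise-All n T reflect QT = scalePF-All Q.½ (λ q → q)
  (AllP.++⁺ QT (scalePF-All (- 1ℚ) (λ q → q) (AllP.map⁺ (All.map reflect QT))))

evalPF-antisymmetrise : ∀ x n T → PolesBelow n T →
  evalPF x (antisymmetrise n T) ≡ Q.½ * (evalPF x T - evalPF (- x - ℕtoℚ n) T)
evalPF-antisymmetrise x n T T≤n = begin
  evalPF x (antisymmetrise n T)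
    ≡⟨ evalPF-scale x Q.½ (T ++ scalePF (- 1ℚ) (reflectPF n T)) ⟩
  Q.½ * evalPF x (T ++ scalePF (- 1ℚ) (reflectPF n T))
    ≡⟨ cong (Q.½ *_) (evalPF-++ x T (scalePF (- 1ℚ) (reflectPF n T))) ⟩
  Q.½ * (evalPF x T + evalPF x (scalePF (- 1ℚ) (reflectPF n T)))
    ≡⟨ cong (λ r → Q.½ * (evalPF x T + r)) (evalPF-scale x (- 1ℚ) (reflectPF n T)) ⟩
  Q.½ * (evalPF x T + (- 1ℚ) * evalPF x (reflectPF n T))
    ≡⟨ cong (λ r → Q.½ * (evalPF x T + (- 1ℚ) * r)) (evalPF-reflect x n T T≤n) ⟩
  Q.½ * (evalPF x T + (- 1ℚ) * evalPF (- x - ℕtoℚ n) T)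
    ≡⟨ cong (λ r → Q.½ * (evalPF x T + r)) (-1*x≈-x _) ⟩
  Q.½ * (evalPF x T - evalPF (- x - ℕtoℚ n) T) ∎
  where open ≡-Reasoning

totalCoeff-antisymmetrise : ∀ s n T →
  totalCoeff s (antisymmetrise n T) ≡ Q.½ * (totalCoeff s T - signPow s * totalCoeff s T)
totalCoeff-antisymmetrise s n T = begin
  totalCoeff s (antisymmetrise n T)
    ≡⟨ totalCoeff-scale s Q.½ (T ++ scalePF (- 1ℚ) (reflectPF n T)) ⟩
  Q.½ * totalCoeff s (T ++ scalePF (- 1ℚ) (reflectPF n T))
    ≡⟨ cong (Q.½ *_) (totalCoeff-++ s T (scalePF (- 1ℚ) (reflectPF n T))) ⟩
  Q.½ * (totalCoeff s T + totalCoeff s (scalePF (- 1ℚ) (reflectPF n T)))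
    ≡⟨ cong (λ r → Q.½ * (totalCoeff s T + r)) (totalCoeff-scale s (- 1ℚ) (reflectPF n T)) ⟩
  Q.½ * (totalCoeff s T + (- 1ℚ) * totalCoeff s (reflectPF n T))
    ≡⟨ cong (λ r → Q.½ * (totalCoeff s T + (- 1ℚ) * r)) (totalCoeff-reflect s n T) ⟩
  Q.½ * (totalCoeff s T + (- 1ℚ) * (signPow s * totalCoeff s T))
    ≡⟨ cong (λ r → Q.½ * (totalCoeff s T + r)) (-1*x≈-x _) ⟩
  Q.½ * (totalCoeff s T - signPow s * totalCoeff s T) ∎
  where open ≡-Reasoning

totalCoeff-antisymmetrise-vanishes : ∀ s n T → totalCoeff s T ≡ 0ℚ → totalCoeff s (antisymmetrise n T) ≡ 0ℚ
totalCoeff-antisymmetrise-vanishes s n T t≡0 = trans (totalCoeff-antisymmetrise s n T)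
  (trans (cong (λ t → Q.½ * (t - signPow s * t)) t≡0) (vanish (signPow s)))
  where
  vanish : ∀ (σ : ℚ) → Q.½ * (0ℚ - σ * 0ℚ) ≡ 0ℚ
  vanish = solve-∀ ℚ-ring

totalCoeff-antisymmetrise-even : ∀ s n T → signPow s ≡ 1ℚ → totalCoeff s (antisymmetrise n T) ≡ 0ℚ
totalCoeff-antisymmetrise-even s n T σ≡1 = trans (totalCoeff-antisymmetrise s n T)
  (trans (cong (λ σ → Q.½ * (totalCoeff s T - σ * totalCoeff s T)) σ≡1) (cancel (totalCoeff s T)))
  where
  cancel : ∀ (t : ℚ) → Q.½ * (t - 1ℚ * t) ≡ 0ℚ
  cancel = solve-∀ ℚ-ring

rising : ℚ → ℕ → ℚ
rising y zero    = 1ℚ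
rising y (suc m) = (y + ℕtoℚ m) * rising y m

rising-suc : ∀ y m → rising y (suc m) ≡ y * rising (y + 1ℚ) m
rising-suc y zero    = shift y
  where
  shift : ∀ (y : ℚ) → (y + 0ℚ) * 1ℚ ≡ y * 1ℚ
  shift = solve-∀ ℚ-ring
rising-suc y (suc m) =
  trans (cong₂ _*_ (cong (y +_) (ℕtoℚ-suc m)) (rising-suc y m)) (reorder y (ℕtoℚ m) (rising (y + 1ℚ) m))
  where
  reorder : ∀ (y m p : ℚ) → (y + (1ℚ + m)) * (y * p) ≡ y * ((y + 1ℚ + m) * p)
  reorder = solve-∀ ℚ-ring

ℕtoℚ-poch : ∀ k m → ℕtoℚ (poch k m) ≡ rising (ℕtoℚ k) m
ℕtoℚ-poch k zero    = refl
ℕtoℚ-poch k (suc m) = begin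
  ℕtoℚ (k ℕ.* poch (suc k) m)           ≡⟨ ℕtoℚ-homo-* k (poch (suc k) m) ⟩
  ℕtoℚ k * ℕtoℚ (poch (suc k) m)        ≡⟨ cong (ℕtoℚ k *_) (ℕtoℚ-poch (suc k) m) ⟩
  ℕtoℚ k * rising (ℕtoℚ (suc k)) m      ≡⟨ cong (λ y → ℕtoℚ k * rising y m) (trans (ℕtoℚ-suc k) (QP.+-comm 1ℚ (ℕtoℚ k))) ⟩
  ℕtoℚ k * rising (ℕtoℚ k + 1ℚ) m       ≡⟨ sym (rising-suc (ℕtoℚ k) m) ⟩
  rising (ℕtoℚ k) (suc m) ∎
  where open ≡-Reasoning

-- The factors of (−y−n)_{n+1} are those of (y)_{n+1} negated and in reverse order.
rising-reflect : ∀ y n → rising (- y - ℕtoℚ n) (suc n) ≡ signPow (suc n) * rising y (suc n)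
rising-reflect y zero    = base y
  where
  base : ∀ (y : ℚ) → (- y - 0ℚ + 0ℚ) * 1ℚ ≡ (- 1ℚ) * ((y + 0ℚ) * 1ℚ)
  base = solve-∀ ℚ-ring
rising-reflect y (suc n) = begin
    rising (- y - ℕtoℚ (suc n)) (suc (suc n))
      ≡⟨ rising-suc (- y - ℕtoℚ (suc n)) (suc n) ⟩
    (- y - ℕtoℚ (suc n)) * rising (- y - ℕtoℚ (suc n) + 1ℚ) (suc n)
      ≡⟨ cong (λ r → (- y - r) * rising (- y - r + 1ℚ) (suc n)) (ℕtoℚ-suc n) ⟩
    (- y - (1ℚ + ℕtoℚ n)) * rising (- y - (1ℚ + ℕtoℚ n) + 1ℚ) (suc n)
      ≡⟨ cong (λ z → (- y - (1ℚ + ℕtoℚ n)) * rising z (suc n)) (shift y (ℕtoℚ n)) ⟩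
    (- y - (1ℚ + ℕtoℚ n)) * rising (- y - ℕtoℚ n) (suc n)
      ≡⟨ cong ((- y - (1ℚ + ℕtoℚ n)) *_) (rising-reflect y n) ⟩
    (- y - (1ℚ + ℕtoℚ n)) * (signPow (suc n) * rising y (suc n))
      ≡⟨ reorder y (ℕtoℚ n) (signPow (suc n)) (rising y (suc n)) ⟩
    (- signPow (suc n)) * ((y + (1ℚ + ℕtoℚ n)) * rising y (suc n))
      ≡⟨ cong (λ r → (- signPow (suc n)) * ((y + r) * rising y (suc n))) (sym (ℕtoℚ-suc n)) ⟩
    signPow (suc (suc n)) * rising y (suc (suc n)) ∎
  where
  open ≡-Reasoning
  shift : ∀ (y m : ℚ) → - y - (1ℚ + m) + 1ℚ ≡ - y - m
  shift = solve-∀ ℚ-ring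
  reorder : ∀ (y m σ p : ℚ) → (- y - (1ℚ + m)) * (σ * p) ≡ (- σ) * ((y + (1ℚ + m)) * p)
  reorder = solve-∀ ℚ-ring

weight : ℕ → ℕ → ℚ → ℚ
weight n A y = inv (rising y (suc n)) ^ℚ A

weight-reflect : ∀ n A y → weight n A (- y - ℕtoℚ n) ≡ signPow (A ℕ.* (n ℕ.+ 1)) * weight n A y
weight-reflect n A y = begin
    inv (rising (- y - ℕtoℚ n) (suc n)) ^ℚ A
      ≡⟨ cong (λ r → inv r ^ℚ A) (rising-reflect y n) ⟩
    inv (σ * rising y (suc n)) ^ℚ A
      ≡⟨ cong (_^ℚ A) (inv-distrib-* σ (rising y (suc n))) ⟩
    (inv σ * inv (rising y (suc n))) ^ℚ A
      ≡⟨ cong (λ r → (r * inv (rising y (suc n))) ^ℚ A) (inv-unique σ σ (signPow-square (suc n))) ⟩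
    (σ * inv (rising y (suc n))) ^ℚ A
      ≡⟨ ^-distrib-* σ (inv (rising y (suc n))) A ⟩
    (σ ^ℚ A) * weight n A y
      ≡⟨ cong (_* weight n A y) (trans (signPow-^ (suc n) A) (cong (λ k → signPow (A ℕ.* k)) (NP.+-comm 1 n))) ⟩
    signPow (A ℕ.* (n ℕ.+ 1)) * weight n A y ∎
  where
  open ≡-Reasoning
  σ = signPow (suc n)

poleList : ℕ → ℕ → List ℕ
poleList n zero    = []
poleList n (suc A) = downFrom (suc n) ++ poleList n A

length-poleList : ∀ n A → length (poleList n A) ≡ A ℕ.* (n ℕ.+ 1)
length-poleList n zero    = refl
length-poleList n (suc A) = trans (length-++ (downFrom (suc n)))
  (cong₂ ℕ._+_ (trans (length-downFrom (suc n)) (NP.+-comm 1 n)) (length-poleList n A))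

poleList-≤ : ∀ n A → All (ℕ._≤ n) (poleList n A)
poleList-≤ n zero    = []
poleList-≤ n (suc A) = AllP.++⁺ (downFrom-≤ (suc n) NP.≤-refl) (poleList-≤ n A)
  where
  downFrom-≤ : ∀ m → m ℕ.≤ suc n → All (ℕ._≤ n) (downFrom m)
  downFrom-≤ zero    _           = []
  downFrom-≤ (suc m) (ℕ.s≤s m≤n) = m≤n ∷ downFrom-≤ m (NP.m≤n⇒m≤1+n m≤n)

multiplicity-poleList : ∀ i n A → i ℕ.≤ n → multiplicity i (poleList n A) ≡ A
multiplicity-poleList i n zero    _   = refl
multiplicity-poleList i n (suc A) i≤n = begin
  multiplicity i (downFrom (suc n) ++ poleList n A)
    ≡⟨ multiplicity-++ (downFrom (suc n)) ⟩
  multiplicity i (downFrom (suc n)) ℕ.+ multiplicity i (poleList n A)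
    ≡⟨ cong₂ ℕ._+_ (multiplicity-downFrom (suc n) (ℕ.s≤s i≤n)) (multiplicity-poleList i n A i≤n) ⟩
  suc A ∎
  where
  open ≡-Reasoning
  multiplicity-++ : ∀ L {L′} → multiplicity i (L ++ L′) ≡ multiplicity i L ℕ.+ multiplicity i L′
  multiplicity-++ []      = refl
  multiplicity-++ (j ∷ L) with i ℕ.≡ᵇ j
  ... | true  = cong suc (multiplicity-++ L)
  ... | false = multiplicity-++ L
  absent : ∀ m → m ℕ.≤ i → multiplicity i (downFrom m) ≡ 0
  absent zero    _   = refl
  absent (suc m) m<i with i ℕ.≡ᵇ m in eq
  ... | true  = ⊥-elim (NP.<-irrefl (sym (NP.≡ᵇ⇒≡ i m (subst Bool.T (sym eq) tt))) m<i)
  ... | false = absent m (NP.<⇒≤ m<i)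
  multiplicity-downFrom : ∀ m → i ℕ.< m → multiplicity i (downFrom m) ≡ 1
  multiplicity-downFrom (suc m) i<1+m with i ℕ.≡ᵇ m in eq
  ... | true = cong suc (absent m (NP.≤-reflexive (sym (NP.≡ᵇ⇒≡ i m (subst Bool.T (sym eq) tt)))))
  ... | false with NP.m≤n⇒m<n∨m≡n (NP.≤-pred i<1+m)
  ...   | inj₁ i<m  = multiplicity-downFrom m i<m
  ...   | inj₂ refl = ⊥-elim (subst Bool.T eq (NP.≡⇒≡ᵇ i i refl))

invProduct-poleList : ∀ y n A → invProduct y (poleList n A) ≡ weight n A y
invProduct-poleList y n zero    = refl
invProduct-poleList y n (suc A) =
  trans (invProduct-++ (downFrom (suc n)) (poleList n A))
        (cong₂ _*_ (invProduct-downFrom (suc n)) (invProduct-poleList y n A))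
  where
  invProduct-++ : ∀ L L′ → invProduct y (L ++ L′) ≡ invProduct y L * invProduct y L′
  invProduct-++ []      L′ = sym (QP.*-identityˡ _)
  invProduct-++ (j ∷ L) L′ =
    trans (cong (inv (y + ℕtoℚ j) *_) (invProduct-++ L L′)) (sym (QP.*-assoc (inv (y + ℕtoℚ j)) _ _))
  invProduct-downFrom : ∀ m → invProduct y (downFrom m) ≡ inv (rising y m)
  invProduct-downFrom zero    = sym inv-1
  invProduct-downFrom (suc m) = trans (cong (inv (y + ℕtoℚ m) *_) (invProduct-downFrom m))
                                      (sym (inv-distrib-* (y + ℕtoℚ m) (rising y m)))

term : ℕ → ℕ → ℕ → ℚ → ℚ
term n A e y = (y ^ℚ e) * weight n A y

oddTermPF : ℕ → ℕ → ℕ → PartialFractions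
oddTermPF n A e = antisymmetrise n (monomialOver (poleList n A) e)

evalPF-oddTermPF : ∀ n A e y → AvoidsPoles n y → e ℕ.≤ A ℕ.* (n ℕ.+ 1) →
  evalPF y (oddTermPF n A e) ≡ Q.½ * (term n A e y - term n A e (- y - ℕtoℚ n))
evalPF-oddTermPF n A e y avoid e≤ =
  trans (evalPF-antisymmetrise y n T (All.map proj₁ (monomialOver-admissible (poleList n A) e (poleList-≤ n A))))
        (cong₂ (λ a b → Q.½ * (a - b)) (correct y avoid) (correct (- y - ℕtoℚ n) (AvoidsPoles-reflect n y avoid)))
  where
  T = monomialOver (poleList n A) e
  correct : ∀ x → AvoidsPoles n x → evalPF x T ≡ term n A e x
  correct x avoid′ =
    trans (monomialOver-correct x (poleList n A) e avoid′ (poleList-≤ n A) (subst (e ℕ.≤_) (sym (length-poleList n A)) e≤))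
          (cong (x ^ℚ e *_) (invProduct-poleList x n A))

oddTermPF-bounds : ∀ n A e → All (λ f → (pole f ℕ.≤ n) × (order f ℕ.≤ A)) (oddTermPF n A e)
oddTermPF-bounds n A e = antisymmetrise-All {λ i s → (i ℕ.≤ n) × (s ℕ.≤ A)} n _ (λ {i} (_ , s≤A) → NP.m∸n≤m n i , s≤A)
  (All.map (λ (i≤n , s≤m) → i≤n , subst (_ ℕ.≤_) (multiplicity-poleList _ n A i≤n) s≤m)
           (monomialOver-admissible (poleList n A) e (poleList-≤ n A)))

oddTermPF-noPolynomialPart : ∀ n A e → e ℕ.< A ℕ.* (n ℕ.+ 1) → NoPolynomialPart (oddTermPF n A e)
oddTermPF-noPolynomialPart n A e e< = antisymmetrise-All {λ _ s → 1 ℕ.≤ s} n _ (λ s≥1 → s≥1)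
  (monomialOver-noPolynomialPart (poleList n A) e (subst (e ℕ.<_) (sym (length-poleList n A)) e<))

OddAtLeast3 : ℕ → Set
OddAtLeast3 s = (3 ℕ.≤ s) × (s ℕ.% 2 ≡ 1)

oddTermPF-totalCoeff : ∀ n A e s → e ℕ.+ 2 ℕ.≤ A ℕ.* (n ℕ.+ 1) → ¬ OddAtLeast3 s →
  totalCoeff s (oddTermPF n A e) ≡ 0ℚ
oddTermPF-totalCoeff n A e s e+2≤ bad with s ℕ.% 2 ℕ.≟ 1
... | no even = totalCoeff-antisymmetrise-even s n (monomialOver (poleList n A) e) (signPow-even s even)
... | yes odd = simple s bad odd
  where
  simple : ∀ s → ¬ OddAtLeast3 s → s ℕ.% 2 ≡ 1 → totalCoeff s (oddTermPF n A e) ≡ 0ℚ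
  simple (suc zero) _ _ = totalCoeff-antisymmetrise-vanishes 1 n (monomialOver (poleList n A) e)
    (monomialOver-totalCoeff-1 (poleList n A) e (subst (suc (suc e) ℕ.≤_) (sym (length-poleList n A))
                                                       (subst (ℕ._≤ A ℕ.* (n ℕ.+ 1)) (NP.+-comm e 2) e+2≤)))
  simple (suc (suc (suc s))) bad odd = ⊥-elim (bad (ℕ.s≤s (ℕ.s≤s (ℕ.s≤s ℕ.z≤n)) , odd))

-- Sequences of rationals

*-monoʳ-≤ : ∀ {p q} r → 0ℚ ≤ r → p ≤ q → p * r ≤ q * r
*-monoʳ-≤ r 0≤r = QP.*-monoʳ-≤-nonNeg r {{Q.nonNegative 0≤r}}

*-monoˡ-≤ : ∀ {p q} r → 0ℚ ≤ r → p ≤ q → r * p ≤ r * q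
*-monoˡ-≤ r 0≤r = QP.*-monoˡ-≤-nonNeg r {{Q.nonNegative 0≤r}}

*-monoʳ-< : ∀ {p q} r → 0ℚ < r → p < q → p * r < q * r
*-monoʳ-< r 0<r = QP.*-monoˡ-<-pos r {{Q.positive 0<r}}

*-monoˡ-< : ∀ {p q} r → 0ℚ < r → p < q → r * p < r * q
*-monoˡ-< r 0<r = QP.*-monoʳ-<-pos r {{Q.positive 0<r}}

0<1 : 0ℚ < 1ℚ
0<1 = Q.*<* (ℤ.+<+ (ℕ.s≤s ℕ.z≤n))

ℕtoℚ-mono-≤ : ∀ {a b} → a ℕ.≤ b → ℕtoℚ a ≤ ℕtoℚ b
ℕtoℚ-mono-≤ {a} {b} a≤b = QP.toℚᵘ-cancel-≤ (subst₂ U._≤_ (sym (ℕtoℚ-toℚᵘ a)) (sym (ℕtoℚ-toℚᵘ b))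
  (U.*≤* (subst₂ ℤ._≤_ (sym (ZP.*-identityʳ (ℤ.+ a))) (sym (ZP.*-identityʳ (ℤ.+ b))) (ℤ.+≤+ a≤b))))

ℕtoℚ-mono-< : ∀ {a b} → a ℕ.< b → ℕtoℚ a < ℕtoℚ b
ℕtoℚ-mono-< {a} {b} a<b = QP.toℚᵘ-cancel-< (subst₂ U._<_ (sym (ℕtoℚ-toℚᵘ a)) (sym (ℕtoℚ-toℚᵘ b))
  (U.*<* (subst₂ ℤ._<_ (sym (ZP.*-identityʳ (ℤ.+ a))) (sym (ZP.*-identityʳ (ℤ.+ b))) (ℤ.+<+ a<b))))

0≤ℕtoℚ : ∀ m → 0ℚ ≤ ℕtoℚ m
0≤ℕtoℚ m = ℕtoℚ-mono-≤ {0} {m} ℕ.z≤n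

0<ℕtoℚ[1+m] : ∀ m → 0ℚ < ℕtoℚ (suc m)
0<ℕtoℚ[1+m] m = ℕtoℚ-mono-< {0} {suc m} (ℕ.s≤s ℕ.z≤n)

0<⇒≢0 : ∀ {y} → 0ℚ < y → y ≢ 0ℚ
0<⇒≢0 0<y y≡0 = QP.<⇒≢ 0<y (sym y≡0)

inv-pos : ∀ y → 0ℚ < y → 0ℚ < inv y
inv-pos y 0<y with 0ℚ QP.<? inv y
... | yes 0<iy = 0<iy
... | no  0≮iy = ⊥-elim (1≰0 (subst₂ _≤_ (trans (QP.*-comm (inv y) y) (*-inv y (0<⇒≢0 0<y))) (QP.*-zeroˡ y)
                         (*-monoʳ-≤ y (QP.<⇒≤ 0<y) (QP.≮⇒≥ 0≮iy))))
  where
  1≰0 : ¬ (1ℚ ≤ 0ℚ)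
  1≰0 (Q.*≤* (ℤ.+≤+ ()))

inv-nonNeg : ∀ y → 0ℚ ≤ y → 0ℚ ≤ inv y
inv-nonNeg y 0≤y with ≡0⊎≢0 y
... | inj₁ refl = QP.≤-refl
... | inj₂ y≢0 with QP.<-cmp 0ℚ y
...   | tri< 0<y _ _ = QP.<⇒≤ (inv-pos y 0<y)
...   | tri≈ _ 0≡y _ = ⊥-elim (y≢0 (sym 0≡y))
...   | tri> _ _ y<0 = ⊥-elim (QP.<-irrefl refl (QP.<-≤-trans y<0 0≤y))

inv-antitone : ∀ a b → 0ℚ < a → a ≤ b → inv b ≤ inv a
inv-antitone a b 0<a a≤b = begin
    inv b                   ≡⟨ sym (QP.*-identityʳ (inv b)) ⟩
    inv b * 1ℚ              ≡⟨ cong (inv b *_) (sym (*-inv a (0<⇒≢0 0<a))) ⟩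
    inv b * (a * inv a)     ≤⟨ *-monoˡ-≤ (inv b) (inv-nonNeg b (QP.<⇒≤ 0<b)) (*-monoʳ-≤ (inv a) (inv-nonNeg a (QP.<⇒≤ 0<a)) a≤b) ⟩
    inv b * (b * inv a)     ≡⟨ sym (QP.*-assoc (inv b) b (inv a)) ⟩
    (inv b * b) * inv a     ≡⟨ cong (_* inv a) (trans (QP.*-comm (inv b) b) (*-inv b (0<⇒≢0 0<b))) ⟩
    1ℚ * inv a              ≡⟨ QP.*-identityˡ (inv a) ⟩
    inv a ∎
  where
  open QP.≤-Reasoning
  0<b = QP.<-≤-trans 0<a a≤b

inv-ℕtoℚ[1+m]-bounds : ∀ m → (0ℚ ≤ inv (ℕtoℚ (suc m))) × (inv (ℕtoℚ (suc m)) ≤ 1ℚ)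
inv-ℕtoℚ[1+m]-bounds m = inv-nonNeg _ (0≤ℕtoℚ (suc m)) ,
  subst (inv (ℕtoℚ (suc m)) ≤_) inv-1 (inv-antitone 1ℚ _ 0<1 (ℕtoℚ-mono-≤ {1} {suc m} (ℕ.s≤s ℕ.z≤n)))

^-bounds : ∀ a s → 0ℚ ≤ a → a ≤ 1ℚ → (0ℚ ≤ a ^ℚ s) × (a ^ℚ s ≤ 1ℚ)
^-bounds a zero    0≤a a≤1 = QP.<⇒≤ 0<1 , QP.≤-refl
^-bounds a (suc s) 0≤a a≤1 with ^-bounds a s 0≤a a≤1
... | 0≤aˢ , aˢ≤1 = subst (_≤ a * (a ^ℚ s)) (QP.*-zeroʳ a) (*-monoˡ-≤ a 0≤a 0≤aˢ) ,
                    QP.≤-trans (*-monoˡ-≤ a 0≤a aˢ≤1) (subst (_≤ 1ℚ) (sym (QP.*-identityʳ a)) a≤1)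

archimedean : ∀ ε → 0ℚ < ε → ∃ λ N → ∀ M → N ℕ.≤ M → inv (ℕtoℚ (suc M)) < ε
archimedean ε@(mkℚ (ℤ.+[1+ a ]) d _) _ = suc d , λ M N≤M →
  QP.≤-<-trans (inv-antitone y (ℕtoℚ (suc M)) (0<ℕtoℚ[1+m] (suc d)) (ℕtoℚ-mono-≤ (ℕ.s≤s N≤M))) iy<ε
  where
  y = ℕtoℚ (suc (suc d))
  1<yε : 1ℚ < y * ε
  1<yε = QP.toℚᵘ-cancel-< (UP.<-respʳ-≃ (UP.≃-sym (QP.toℚᵘ-homo-* y ε))
    (subst (λ z → toℚᵘ 1ℚ U.< z U.* toℚᵘ ε) (sym (ℕtoℚ-toℚᵘ (suc (suc d))))
      (U.*<* (subst₂ ℤ._<_ (sym (trans (ZP.*-identityˡ _) (ZP.*-identityˡ _)))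
               (trans (ZP.pos-* (suc (suc d)) (suc a)) (sym (ZP.*-identityʳ _)))
               (ℤ.+<+ (NP.<-≤-trans (NP.n<1+n (suc d)) (NP.m≤m*n (suc (suc d)) (suc a))))))))
  iy<ε : inv y < ε
  iy<ε = begin-strict
    inv y               ≡⟨ sym (QP.*-identityʳ (inv y)) ⟩
    inv y * 1ℚ          <⟨ *-monoˡ-< (inv y) (inv-pos y (0<ℕtoℚ[1+m] (suc d))) 1<yε ⟩
    inv y * (y * ε)     ≡⟨ sym (QP.*-assoc (inv y) y ε) ⟩
    (inv y * y) * ε     ≡⟨ cong (_* ε) (trans (QP.*-comm (inv y) y) (*-inv y (0<⇒≢0 (0<ℕtoℚ[1+m] (suc d))))) ⟩
    1ℚ * ε              ≡⟨ QP.*-identityˡ ε ⟩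
    ε ∎
    where open QP.≤-Reasoning
archimedean (mkℚ (ℤ.+ 0) _ _)        (Q.*<* (ℤ.+<+ ()))
archimedean (mkℚ ℤ.-[1+ _ ] _ _)    (Q.*<* ())

TendsToZero : (ℕ → ℚ) → Set
TendsToZero f = ∀ ε → 0ℚ < ε → ∃ λ N → ∀ M → N ℕ.≤ M → ∣ f M ∣ < ε

EventuallyBounded : (ℕ → ℚ) → Set
EventuallyBounded f = ∃ λ K → ∃ λ N → ∀ M → N ℕ.≤ M → ∣ f M ∣ ≤ K

0<bound+1 : ∀ {g : ℕ → ℚ} {K N} → (∀ M → N ℕ.≤ M → ∣ g M ∣ ≤ K) → 0ℚ < K + 1ℚ
0<bound+1 {g} {K} {N} bound = QP.<-≤-trans 0<1 (subst (_≤ K + 1ℚ) (QP.+-identityˡ 1ℚ)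
  (QP.+-monoˡ-≤ 1ℚ (QP.≤-trans (QP.0≤∣p∣ (g N)) (bound N NP.≤-refl))))

TendsToZero-cong : ∀ {f g} → (∀ M → f M ≡ g M) → TendsToZero f → TendsToZero g
TendsToZero-cong f≡g f→0 ε 0<ε with f→0 ε 0<ε
... | N , small = N , λ M N≤M → subst (λ z → ∣ z ∣ < ε) (f≡g M) (small M N≤M)

EventuallyBounded-cong : ∀ {f g} → (∀ M → f M ≡ g M) → EventuallyBounded f → EventuallyBounded g
EventuallyBounded-cong f≡g (K , N , bound) = K , N , λ M N≤M → subst (λ z → ∣ z ∣ ≤ K) (f≡g M) (bound M N≤M)

TendsToZero-0 : TendsToZero (λ _ → 0ℚ)
TendsToZero-0 ε 0<ε = 0 , λ _ _ → 0<ε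

TendsToZero-+ : ∀ {f g} → TendsToZero f → TendsToZero g → TendsToZero (λ M → f M + g M)
TendsToZero-+ {f} {g} f→0 g→0 ε 0<ε with f→0 (Q.½ * ε) 0<ε/2 | g→0 (Q.½ * ε) 0<ε/2
  where
  0<ε/2 = subst (_< Q.½ * ε) (QP.*-zeroʳ Q.½) (*-monoˡ-< Q.½ (Q.*<* (ℤ.+<+ (ℕ.s≤s ℕ.z≤n))) 0<ε)
... | N₁ , small₁ | N₂ , small₂ = N₁ ⊔ N₂ , λ M N≤M →
  QP.≤-<-trans (QP.∣p+q∣≤∣p∣+∣q∣ (f M) (g M))
    (subst (∣ f M ∣ + ∣ g M ∣ <_) (halves ε)
      (QP.+-mono-< (small₁ M (NP.≤-trans (NP.m≤m⊔n N₁ N₂) N≤M)) (small₂ M (NP.≤-trans (NP.m≤n⊔m N₁ N₂) N≤M))))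
  where
  halves : ∀ (ε : ℚ) → Q.½ * ε + Q.½ * ε ≡ ε
  halves = solve-∀ ℚ-ring

TendsToZero-*-bounded : ∀ {f g} → TendsToZero f → EventuallyBounded g → TendsToZero (λ M → f M * g M)
TendsToZero-*-bounded {f} {g} f→0 (K , N₀ , bound) ε 0<ε
  with f→0 (ε * inv (K + 1ℚ)) (subst (_< ε * inv (K + 1ℚ)) (QP.*-zeroˡ (inv (K + 1ℚ)))
                                 (*-monoʳ-< (inv (K + 1ℚ)) (inv-pos _ (0<bound+1 bound)) 0<ε))
... | N₁ , small = N₀ ⊔ N₁ , λ M N≤M → begin-strict
    ∣ f M * g M ∣               ≡⟨ QP.∣p*q∣≡∣p∣*∣q∣ (f M) (g M) ⟩
    ∣ f M ∣ * ∣ g M ∣           ≤⟨ *-monoˡ-≤ ∣ f M ∣ (QP.0≤∣p∣ (f M)) (QP.≤-trans (bound M (NP.≤-trans (NP.m≤m⊔n N₀ N₁) N≤M)) K≤K+1) ⟩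
    ∣ f M ∣ * (K + 1ℚ)          <⟨ *-monoʳ-< (K + 1ℚ) 0<K+1 (small M (NP.≤-trans (NP.m≤n⊔m N₀ N₁) N≤M)) ⟩
    ε * inv (K + 1ℚ) * (K + 1ℚ) ≡⟨ QP.*-assoc ε (inv (K + 1ℚ)) (K + 1ℚ) ⟩
    ε * (inv (K + 1ℚ) * (K + 1ℚ)) ≡⟨ cong (ε *_) (trans (QP.*-comm (inv (K + 1ℚ)) _) (*-inv (K + 1ℚ) (0<⇒≢0 0<K+1))) ⟩
    ε * 1ℚ                      ≡⟨ QP.*-identityʳ ε ⟩
    ε ∎
  where
  open QP.≤-Reasoning
  0<K+1 = 0<bound+1 bound
  K≤K+1 = subst (_≤ K + 1ℚ) (QP.+-identityʳ K) (QP.+-monoʳ-≤ K (QP.<⇒≤ 0<1))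

EventuallyBounded-const : ∀ c → EventuallyBounded (λ _ → c)
EventuallyBounded-const c = ∣ c ∣ , 0 , λ _ _ → QP.≤-refl

TendsToZero-bounded-* : ∀ {f g} → EventuallyBounded g → TendsToZero f → TendsToZero (λ M → g M * f M)
TendsToZero-bounded-* {f} {g} g-bounded f→0 =
  TendsToZero-cong (λ M → QP.*-comm (f M) (g M)) (TendsToZero-*-bounded f→0 g-bounded)

TendsToZero-scale : ∀ {f} c → TendsToZero f → TendsToZero (λ M → c * f M)
TendsToZero-scale c = TendsToZero-bounded-* (EventuallyBounded-const c)

TendsToZero⇒EventuallyBounded : ∀ {f} → TendsToZero f → EventuallyBounded f
TendsToZero⇒EventuallyBounded f→0 with f→0 1ℚ 0<1
... | N , small = 1ℚ , N , λ M N≤M → QP.<⇒≤ (small M N≤M)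

EventuallyBounded-+ : ∀ {f g} → EventuallyBounded f → EventuallyBounded g → EventuallyBounded (λ M → f M + g M)
EventuallyBounded-+ {f} {g} (K₁ , N₁ , bound₁) (K₂ , N₂ , bound₂) = K₁ + K₂ , N₁ ⊔ N₂ , λ M N≤M →
  QP.≤-trans (QP.∣p+q∣≤∣p∣+∣q∣ (f M) (g M))
    (QP.+-mono-≤ (bound₁ M (NP.≤-trans (NP.m≤m⊔n N₁ N₂) N≤M)) (bound₂ M (NP.≤-trans (NP.m≤n⊔m N₁ N₂) N≤M)))

EventuallyBounded-* : ∀ {f g} → EventuallyBounded f → EventuallyBounded g → EventuallyBounded (λ M → f M * g M)
EventuallyBounded-* {f} {g} (K₁ , N₁ , bound₁) (K₂ , N₂ , bound₂) = K₁ * K₂ , N₁ ⊔ N₂ , λ M N≤M →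
  let fM≤K₁ = bound₁ M (NP.≤-trans (NP.m≤m⊔n N₁ N₂) N≤M)
      gM≤K₂ = bound₂ M (NP.≤-trans (NP.m≤n⊔m N₁ N₂) N≤M)
  in QP.≤-trans (QP.≤-reflexive (QP.∣p*q∣≡∣p∣*∣q∣ (f M) (g M)))
       (QP.≤-trans (*-monoʳ-≤ ∣ g M ∣ (QP.0≤∣p∣ (g M)) fM≤K₁)
                   (*-monoˡ-≤ K₁ (QP.≤-trans (QP.0≤∣p∣ (f M)) fM≤K₁) gM≤K₂))

TendsToZero-inv-shifted-^ : ∀ m s → TendsToZero (λ M → inv (ℕtoℚ (M ℕ.+ suc m)) ^ℚ suc s)
TendsToZero-inv-shifted-^ m s = TendsToZero-*-bounded base (1ℚ , 0 , λ M _ →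
    let bounds = ^-bounds (inv (ℕtoℚ (M ℕ.+ suc m))) s (proj₁ (unit M)) (proj₂ (unit M))
    in subst (_≤ 1ℚ) (sym (QP.0≤p⇒∣p∣≡p (proj₁ bounds))) (proj₂ bounds))
  where
  unit : ∀ M → (0ℚ ≤ inv (ℕtoℚ (M ℕ.+ suc m))) × (inv (ℕtoℚ (M ℕ.+ suc m)) ≤ 1ℚ)
  unit M = subst (λ z → (0ℚ ≤ inv (ℕtoℚ z)) × (inv (ℕtoℚ z) ≤ 1ℚ)) (sym (NP.+-suc M m))
                 (inv-ℕtoℚ[1+m]-bounds (M ℕ.+ m))
  base : TendsToZero (λ M → inv (ℕtoℚ (M ℕ.+ suc m)))
  base ε 0<ε with archimedean ε 0<ε
  ... | N , small = N , λ M N≤M → QP.≤-<-trans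
    (QP.≤-trans (QP.≤-reflexive (QP.0≤p⇒∣p∣≡p (proj₁ (unit M))))
                (inv-antitone (ℕtoℚ (suc M)) _ (0<ℕtoℚ[1+m] M)
                  (ℕtoℚ-mono-≤ (subst (suc M ℕ.≤_) (sym (NP.+-suc M m)) (ℕ.s≤s (NP.m≤m+n M m))))))
    (small M N≤M)

-- Partial sums of partial fractions

rangeSum-cong : ∀ M {f g : ℕ → ℚ} → (∀ k → 1 ℕ.≤ k → f k ≡ g k) → rangeSum M f ≡ rangeSum M g
rangeSum-cong zero    f≡g = refl
rangeSum-cong (suc M) f≡g = cong₂ _+_ (rangeSum-cong M f≡g) (f≡g (suc M) (ℕ.s≤s ℕ.z≤n))

rangeSum-0 : ∀ M → rangeSum M (λ _ → 0ℚ) ≡ 0ℚ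
rangeSum-0 zero    = refl
rangeSum-0 (suc M) = cong (_+ 0ℚ) (rangeSum-0 M)

rangeSum-+ : ∀ M (f g : ℕ → ℚ) → rangeSum M (λ k → f k + g k) ≡ rangeSum M f + rangeSum M g
rangeSum-+ zero    f g = refl
rangeSum-+ (suc M) f g = trans (cong (_+ (f (suc M) + g (suc M))) (rangeSum-+ M f g))
  (+-interchange (rangeSum M f) (rangeSum M g) (f (suc M)) (g (suc M)))

rangeSum-scale : ∀ M c (f : ℕ → ℚ) → rangeSum M (λ k → c * f k) ≡ c * rangeSum M f
rangeSum-scale zero    c f = sym (QP.*-zeroʳ c)
rangeSum-scale (suc M) c f =
  trans (cong (_+ c * f (suc M)) (rangeSum-scale M c f)) (sym (QP.*-distribˡ-+ c (rangeSum M f) (f (suc M))))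

rangeSum-nonNeg : ∀ M (g : ℕ → ℚ) → (∀ k → 0ℚ ≤ g k) → 0ℚ ≤ rangeSum M g
rangeSum-nonNeg zero    g 0≤g = QP.≤-refl
rangeSum-nonNeg (suc M) g 0≤g = QP.+-mono-≤ (rangeSum-nonNeg M g 0≤g) (0≤g (suc M))

rangeSum-shift : ∀ (g : ℕ → ℚ) i M →
  rangeSum M (λ k → g (k ℕ.+ i)) ≡ rangeSum M g + (rangeSum i (λ m → g (M ℕ.+ m)) - rangeSum i g)
rangeSum-shift g i zero    = sym (trans (QP.+-identityˡ _) (QP.+-inverseʳ (rangeSum i g)))
rangeSum-shift g i (suc M) = trans (cong (_+ g (suc M ℕ.+ i)) (rangeSum-shift g i M))
  (regroup (rangeSum M g) (rangeSum i (λ m → g (M ℕ.+ m))) (rangeSum i g) (g (suc M ℕ.+ i))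
           (rangeSum i (λ m → g (suc M ℕ.+ m))) (g (suc M)) window)
  where
  regroup : ∀ (R T C x T′ y : ℚ) → T′ + y ≡ T + x → R + (T - C) + x ≡ (R + y) + (T′ - C)
  regroup R T C x T′ y e = trans (collect R T C x) (trans (cong (λ z → R + (z - C)) (sym e)) (expand R T′ C y))
    where
    collect : ∀ (R T C x : ℚ) → R + (T - C) + x ≡ R + ((T + x) - C)
    collect = solve-∀ ℚ-ring
    expand : ∀ (R T′ C y : ℚ) → R + ((T′ + y) - C) ≡ (R + y) + (T′ - C)
    expand = solve-∀ ℚ-ring
  h : ℕ → ℚ
  h m = g (M ℕ.+ m)
  telescope : ∀ i → rangeSum i (λ m → h (suc m)) + h 1 ≡ rangeSum i h + h (suc i)
  telescope zero    = refl
  telescope (suc i) = trans (swap (rangeSum i (λ m → h (suc m))) (h 1) (h (suc (suc i))))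
    (cong (_+ h (suc (suc i))) (telescope i))
    where
    swap : ∀ (a b x : ℚ) → a + x + b ≡ (a + b) + x
    swap = solve-∀ ℚ-ring
  window : rangeSum i (λ m → g (suc M ℕ.+ m)) + g (suc M) ≡ rangeSum i (λ m → g (M ℕ.+ m)) + g (suc M ℕ.+ i)
  window = trans (cong₂ _+_ (rangeSum-cong i (λ m _ → cong g (sym (NP.+-suc M m))))
                            (cong g (trans (cong suc (sym (NP.+-identityʳ M))) (sym (NP.+-suc M 0)))))
                 (trans (telescope i) (cong (λ z → rangeSum i h + g z) (NP.+-suc M i)))

invPow : ℕ → ℕ → ℚ
invPow s m = inv (ℕtoℚ m) ^ℚ s

zetaTrunc≡rangeSum-invPow : ∀ s M → zetaTrunc s M ≡ rangeSum M (invPow s)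
zetaTrunc≡rangeSum-invPow s M = rangeSum-cong M (λ k _ → invℕ-^ k s)

zetaPart : PartialFractions → ℕ → ℚ
zetaPart []               M = 0ℚ
zetaPart (frac c i s ∷ T) M = c * zetaTrunc s M + zetaPart T M

constantPart : PartialFractions → ℚ
constantPart []               = 0ℚ
constantPart (frac c i s ∷ T) = c * (- rangeSum i (invPow s)) + constantPart T

tailPart : PartialFractions → ℕ → ℚ
tailPart []               M = 0ℚ
tailPart (frac c i s ∷ T) M = c * rangeSum i (λ m → invPow s (M ℕ.+ m)) + tailPart T M

-- Σ_{k ≤ M} 1/(k+i)^s = ζ_M(s) − Σ_{m ≤ i} 1/m^s + Σ_{m ≤ i} 1/(M+m)^s.
rangeSum-evalPF : ∀ T M → rangeSum M (λ k → evalPF (ℕtoℚ k) T) ≡ zetaPart T M + constantPart T + tailPart T M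
rangeSum-evalPF [] M = rangeSum-0 M
rangeSum-evalPF (frac c i s ∷ T) M = begin
    rangeSum M (λ k → evalFraction (ℕtoℚ k) (frac c i s) + evalPF (ℕtoℚ k) T)
      ≡⟨ rangeSum-+ M (λ k → evalFraction (ℕtoℚ k) (frac c i s)) (λ k → evalPF (ℕtoℚ k) T) ⟩
    rangeSum M (λ k → c * (inv (ℕtoℚ k + ℕtoℚ i) ^ℚ s)) + rangeSum M (λ k → evalPF (ℕtoℚ k) T)
      ≡⟨ cong₂ _+_ fraction (rangeSum-evalPF T M) ⟩
    (c * ζ + c * (- head) + c * tail) + (zetaPart T M + constantPart T + tailPart T M)
      ≡⟨ interchange (c * ζ) (c * (- head)) (c * tail) (zetaPart T M) (constantPart T) (tailPart T M) ⟩
    (c * ζ + zetaPart T M) + (c * (- head) + constantPart T) + (c * tail + tailPart T M) ∎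
  where
  open ≡-Reasoning
  ζ    = zetaTrunc s M
  head = rangeSum i (invPow s)
  tail = rangeSum i (λ m → invPow s (M ℕ.+ m))
  interchange : ∀ (a b c d e f : ℚ) → (a + b + c) + (d + e + f) ≡ (a + d) + (b + e) + (c + f)
  interchange = solve-∀ ℚ-ring
  distribute : ∀ (c z t r : ℚ) → c * (z + (t - r)) ≡ c * z + c * (- r) + c * t
  distribute = solve-∀ ℚ-ring
  fraction : rangeSum M (λ k → c * (inv (ℕtoℚ k + ℕtoℚ i) ^ℚ s)) ≡ c * ζ + c * (- head) + c * tail
  fraction = begin
    rangeSum M (λ k → c * (inv (ℕtoℚ k + ℕtoℚ i) ^ℚ s))
      ≡⟨ rangeSum-scale M c (λ k → inv (ℕtoℚ k + ℕtoℚ i) ^ℚ s) ⟩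
    c * rangeSum M (λ k → inv (ℕtoℚ k + ℕtoℚ i) ^ℚ s)
      ≡⟨ cong (c *_) (rangeSum-cong M (λ k _ → cong (λ z → inv z ^ℚ s) (sym (ℕtoℚ-homo-+ k i)))) ⟩
    c * rangeSum M (λ k → invPow s (k ℕ.+ i))
      ≡⟨ cong (c *_) (rangeSum-shift (invPow s) i M) ⟩
    c * (rangeSum M (invPow s) + (tail - head))
      ≡⟨ cong (λ z → c * (z + (tail - head))) (sym (zetaTrunc≡rangeSum-invPow s M)) ⟩
    c * (ζ + (tail - head))
      ≡⟨ distribute c ζ tail head ⟩
    c * ζ + c * (- head) + c * tail ∎

tailPart→0 : ∀ T → NoPolynomialPart T → TendsToZero (tailPart T)
tailPart→0 []                     []        = TendsToZero-0
tailPart→0 (frac c i (suc s) ∷ T) (_ ∷ pos) = TendsToZero-+ (TendsToZero-scale c (tail→0 i)) (tailPart→0 T pos)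
  where
  tail→0 : ∀ i → TendsToZero (λ M → rangeSum i (λ m → invPow (suc s) (M ℕ.+ m)))
  tail→0 zero    = TendsToZero-0
  tail→0 (suc i) = TendsToZero-+ (tail→0 i) (TendsToZero-inv-shifted-^ i s)

invPow-nonNeg : ∀ s m → 0ℚ ≤ invPow s m
invPow-nonNeg s zero    = proj₁ (^-bounds 0ℚ s QP.≤-refl (QP.<⇒≤ 0<1))
invPow-nonNeg s (suc m) = proj₁ (^-bounds _ s (proj₁ (inv-ℕtoℚ[1+m]-bounds m)) (proj₂ (inv-ℕtoℚ[1+m]-bounds m)))

inv-consecutive-product : ∀ a →
  inv (ℕtoℚ (suc a) * ℕtoℚ (suc (suc a))) ≡ inv (ℕtoℚ (suc a)) - inv (ℕtoℚ (suc (suc a)))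
inv-consecutive-product a = inv-unique (y₁ * y₂) (inv y₁ - inv y₂) (begin
    (y₁ * y₂) * (inv y₁ - inv y₂)           ≡⟨ expand y₁ y₂ (inv y₁) (inv y₂) ⟩
    y₂ * (y₁ * inv y₁) - y₁ * (y₂ * inv y₂) ≡⟨ cong₂ (λ u v → y₂ * u - y₁ * v) (*-inv y₁ (ℕtoℚ[1+m]≢0 a))
                                                                            (*-inv y₂ (ℕtoℚ[1+m]≢0 (suc a))) ⟩
    y₂ * 1ℚ - y₁ * 1ℚ                       ≡⟨ cong (λ w → w * 1ℚ - y₁ * 1ℚ) (ℕtoℚ-suc (suc a)) ⟩
    (1ℚ + y₁) * 1ℚ - y₁ * 1ℚ                ≡⟨ difference y₁ ⟩
    1ℚ ∎)
  where
  open ≡-Reasoning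
  y₁ = ℕtoℚ (suc a)
  y₂ = ℕtoℚ (suc (suc a))
  expand : ∀ (y₁ y₂ a b : ℚ) → (y₁ * y₂) * (a - b) ≡ y₂ * (y₁ * a) - y₁ * (y₂ * b)
  expand = solve-∀ ℚ-ring
  difference : ∀ (y : ℚ) → (1ℚ + y) * 1ℚ - y * 1ℚ ≡ 1ℚ
  difference = solve-∀ ℚ-ring

inv-square-≤-consecutive : ∀ a → inv (ℕtoℚ (suc (suc a))) ^ℚ 2 ≤ inv (ℕtoℚ (suc a) * ℕtoℚ (suc (suc a)))
inv-square-≤-consecutive a = QP.≤-trans
  (QP.≤-reflexive (trans (cong (inv y₂ *_) (QP.*-identityʳ (inv y₂))) (sym (inv-distrib-* y₂ y₂))))
  (inv-antitone (y₁ * y₂) (y₂ * y₂)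
    (subst (_< y₁ * y₂) (QP.*-zeroˡ y₂) (*-monoʳ-< y₂ (0<ℕtoℚ[1+m] (suc a)) (0<ℕtoℚ[1+m] a)))
    (*-monoʳ-≤ y₂ (0≤ℕtoℚ (suc (suc a))) (ℕtoℚ-mono-≤ (NP.n≤1+n (suc a)))))
  where
  y₁ = ℕtoℚ (suc a)
  y₂ = ℕtoℚ (suc (suc a))

-- The terms 1/(a+2)^(s+2) ≤ 1/(a+1) − 1/(a+2) telescope.
zetaTrunc-≤-2 : ∀ s M → zetaTrunc (suc (suc s)) M ≤ 1ℚ + 1ℚ
zetaTrunc-≤-2 s zero    = QP.<⇒≤ (Q.*<* (ℤ.+<+ (ℕ.s≤s ℕ.z≤n)))
zetaTrunc-≤-2 s (suc M) = begin
  zetaTrunc (suc (suc s)) (suc M)       ≡⟨ zetaTrunc≡rangeSum-invPow (suc (suc s)) (suc M) ⟩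
  Z                                     ≤⟨ subst (_≤ Z + inv (ℕtoℚ (suc M))) (QP.+-identityʳ Z)
                                             (QP.+-monoʳ-≤ Z (proj₁ (inv-ℕtoℚ[1+m]-bounds M))) ⟩
  Z + inv (ℕtoℚ (suc M))                ≤⟨ telescoped M ⟩
  1ℚ + 1ℚ ∎
  where
  open QP.≤-Reasoning
  Z = rangeSum (suc M) (invPow (suc (suc s)))
  telescoped : ∀ M → rangeSum (suc M) (invPow (suc (suc s))) + inv (ℕtoℚ (suc M)) ≤ 1ℚ + 1ℚ
  telescoped zero    = QP.≤-reflexive (cong (λ r → 0ℚ + r + 1ℚ) (1^ (suc (suc s))))
  telescoped (suc M) = QP.≤-trans step (telescoped M)
    where
    R  = rangeSum (suc M) (invPow (suc (suc s)))
    i₁ = inv (ℕtoℚ (suc M))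
    i₂ = inv (ℕtoℚ (suc (suc M)))
    i₂-bounds = inv-ℕtoℚ[1+m]-bounds (suc M)
    term≤ : invPow (suc (suc s)) (suc (suc M)) ≤ i₁ - i₂
    term≤ = QP.≤-trans
      (*-monoˡ-≤ i₂ (proj₁ i₂-bounds) (*-monoˡ-≤ i₂ (proj₁ i₂-bounds) (proj₂ (^-bounds i₂ s (proj₁ i₂-bounds) (proj₂ i₂-bounds)))))
      (QP.≤-trans (inv-square-≤-consecutive M) (QP.≤-reflexive (inv-consecutive-product M)))
    cancel : ∀ (R d i₂ : ℚ) → R + (d - i₂) + i₂ ≡ R + d
    cancel = solve-∀ ℚ-ring
    step : R + invPow (suc (suc s)) (suc (suc M)) + i₂ ≤ R + i₁
    step = QP.≤-trans (QP.+-monoˡ-≤ i₂ (QP.+-monoʳ-≤ R term≤)) (QP.≤-reflexive (cancel R i₁ i₂))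

zetaTrunc-bounded : ∀ s → EventuallyBounded (zetaTrunc (suc (suc s)))
zetaTrunc-bounded s = 1ℚ + 1ℚ , 0 , λ M _ → QP.≤-trans
  (QP.≤-reflexive (QP.0≤p⇒∣p∣≡p (subst (0ℚ ≤_) (sym (zetaTrunc≡rangeSum-invPow (suc (suc s)) M))
                                   (rangeSum-nonNeg M _ (invPow-nonNeg (suc (suc s)))))))
  (zetaTrunc-≤-2 s M)

-- Polynomials

Monomial : ℕ → Set
Monomial k = ℚ × (Fin k → ℕ)

evalMonomial : ∀ {k} → Monomial k → (Fin k → ℚ) → ℚ
evalMonomial {k} (c , e) x = c * prodFinℚ k (λ i → x i ^ℚ e i)

zeroExp : ∀ {m} → Fin m → ℕ
zeroExp _ = 0

unitExp : ∀ {m} → Fin m → Fin m → ℕ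
unitExp zero    zero    = 1
unitExp zero    (suc _) = 0
unitExp (suc _) zero    = 0
unitExp (suc s) (suc i) = unitExp s i

prodFinℚ-cong : ∀ m {f g : Fin m → ℚ} → (∀ i → f i ≡ g i) → prodFinℚ m f ≡ prodFinℚ m g
prodFinℚ-cong zero    f≡g = refl
prodFinℚ-cong (suc m) f≡g = cong₂ _*_ (f≡g zero) (prodFinℚ-cong m (λ i → f≡g (suc i)))

prodFinℚ-* : ∀ m (f g : Fin m → ℚ) → prodFinℚ m (λ i → f i * g i) ≡ prodFinℚ m f * prodFinℚ m g
prodFinℚ-* zero    f g = refl
prodFinℚ-* (suc m) f g = trans (cong (f zero * g zero *_) (prodFinℚ-* m (λ i → f (suc i)) (λ i → g (suc i))))
  (*-interchange (f zero) (g zero) _ _)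

prodFinℚ-zeroExp : ∀ m (x : Fin m → ℚ) → prodFinℚ m (λ i → x i ^ℚ zeroExp i) ≡ 1ℚ
prodFinℚ-zeroExp zero    x = refl
prodFinℚ-zeroExp (suc m) x = cong (1ℚ *_) (prodFinℚ-zeroExp m (λ i → x (suc i)))

prodFinℚ-unitExp : ∀ m (s : Fin m) (x : Fin m → ℚ) → prodFinℚ m (λ i → x i ^ℚ unitExp s i) ≡ x s
prodFinℚ-unitExp (suc m) zero    x =
  trans (cong ((x zero * 1ℚ) *_) (prodFinℚ-zeroExp m (λ i → x (suc i))))
        (trans (QP.*-identityʳ _) (QP.*-identityʳ (x zero)))
prodFinℚ-unitExp (suc m) (suc s) x = trans (QP.*-identityˡ _) (prodFinℚ-unitExp m s (λ i → x (suc i)))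

evalPoly-++ : ∀ {k} (P Q : Poly k) x → evalPoly (P ++ Q) x ≡ evalPoly P x + evalPoly Q x
evalPoly-++ []            Q x = sym (QP.+-identityˡ (evalPoly Q x))
evalPoly-++ (mon ∷ P) Q x = trans (cong (evalMonomial mon x +_) (evalPoly-++ P Q x))
  (sym (QP.+-assoc (evalMonomial mon x) (evalPoly P x) (evalPoly Q x)))

evalPoly-tabulate : ∀ {k} m (f : Fin m → Monomial k) x → evalPoly (tabulate f) x ≡ sum (λ s → evalMonomial (f s) x)
evalPoly-tabulate zero    f x = refl
evalPoly-tabulate (suc m) f x = cong (evalMonomial (f zero) x +_) (evalPoly-tabulate m (λ i → f (suc i)) x)

mulMonomial : ∀ {k} → Monomial k → Monomial k → Monomial k
mulMonomial (c , e) (c′ , e′) = c * c′ , λ i → e i ℕ.+ e′ i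

evalMonomial-mul : ∀ {k} (m m′ : Monomial k) x →
  evalMonomial (mulMonomial m m′) x ≡ evalMonomial m x * evalMonomial m′ x
evalMonomial-mul {k} (c , e) (c′ , e′) x = begin
  (c * c′) * prodFinℚ k (λ i → x i ^ℚ (e i ℕ.+ e′ i))
    ≡⟨ cong ((c * c′) *_) (prodFinℚ-cong k (λ i → ^-+ (x i) (e i) (e′ i))) ⟩
  (c * c′) * prodFinℚ k (λ i → (x i ^ℚ e i) * (x i ^ℚ e′ i))
    ≡⟨ cong ((c * c′) *_) (prodFinℚ-* k (λ i → x i ^ℚ e i) (λ i → x i ^ℚ e′ i)) ⟩
  (c * c′) * (prodFinℚ k (λ i → x i ^ℚ e i) * prodFinℚ k (λ i → x i ^ℚ e′ i))
    ≡⟨ *-interchange c c′ _ _ ⟩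
  (c * prodFinℚ k (λ i → x i ^ℚ e i)) * (c′ * prodFinℚ k (λ i → x i ^ℚ e′ i)) ∎
  where open ≡-Reasoning

mulPoly : ∀ {k} → Poly k → Poly k → Poly k
mulPoly []        Q = []
mulPoly (mon ∷ P) Q = map (mulMonomial mon) Q ++ mulPoly P Q

evalPoly-mulPoly : ∀ {k} (P Q : Poly k) x → evalPoly (mulPoly P Q) x ≡ evalPoly P x * evalPoly Q x
evalPoly-mulPoly []        Q x = sym (QP.*-zeroˡ (evalPoly Q x))
evalPoly-mulPoly (mon ∷ P) Q x = begin
  evalPoly (map (mulMonomial mon) Q ++ mulPoly P Q) x
    ≡⟨ evalPoly-++ (map (mulMonomial mon) Q) (mulPoly P Q) x ⟩
  evalPoly (map (mulMonomial mon) Q) x + evalPoly (mulPoly P Q) x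
    ≡⟨ cong₂ _+_ (evalPoly-map Q) (evalPoly-mulPoly P Q x) ⟩
  evalMonomial mon x * evalPoly Q x + evalPoly P x * evalPoly Q x
    ≡⟨ sym (QP.*-distribʳ-+ (evalPoly Q x) (evalMonomial mon x) (evalPoly P x)) ⟩
  (evalMonomial mon x + evalPoly P x) * evalPoly Q x ∎
  where
  open ≡-Reasoning
  evalPoly-map : ∀ Q → evalPoly (map (mulMonomial mon) Q) x ≡ evalMonomial mon x * evalPoly Q x
  evalPoly-map []         = sym (QP.*-zeroʳ (evalMonomial mon x))
  evalPoly-map (mon′ ∷ Q) = trans (cong₂ _+_ (evalMonomial-mul mon mon′ x) (evalPoly-map Q))
    (sym (QP.*-distribˡ-+ (evalMonomial mon x) _ _))

prodPoly : ∀ {k} p → (Fin p → Poly k) → Poly k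
prodPoly zero    P = (1ℚ , zeroExp) ∷ []
prodPoly (suc p) P = mulPoly (P zero) (prodPoly p (λ j → P (suc j)))

evalPoly-prodPoly : ∀ {k} p (P : Fin p → Poly k) x → evalPoly (prodPoly p P) x ≡ prodFinℚ p (λ j → evalPoly (P j) x)
evalPoly-prodPoly {k} zero    P x = trans (QP.+-identityʳ _) (trans (QP.*-identityˡ _) (prodFinℚ-zeroExp k x))
evalPoly-prodPoly     (suc p) P x = trans (evalPoly-mulPoly (P zero) (prodPoly p (λ j → P (suc j))) x)
  (cong (evalPoly (P zero) x *_) (evalPoly-prodPoly p (λ j → P (suc j)) x))

AllMon-++ : ∀ {k} {Q : (Fin k → ℕ) → Set} (P R : Poly k) → AllMon Q P → AllMon Q R → AllMon Q (P ++ R)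
AllMon-++ []      R []       QR = QR
AllMon-++ (_ ∷ P) R (q ∷ QP) QR = q ∷ AllMon-++ P R QP QR

AllMon-tabulate : ∀ {k} {Q : (Fin k → ℕ) → Set} m (f : Fin m → Monomial k) →
  (∀ s → proj₁ (f s) ≢ 0ℚ → Q (proj₂ (f s))) → AllMon Q (tabulate f)
AllMon-tabulate zero    f Qf = []
AllMon-tabulate (suc m) f Qf = Qf zero ∷ AllMon-tabulate m (λ i → f (suc i)) (λ i → Qf (suc i))

AllMon-mulPoly : ∀ {k} {Q₁ Q₂ Q : (Fin k → ℕ) → Set} → (∀ {e e′} → Q₁ e → Q₂ e′ → Q (λ i → e i ℕ.+ e′ i)) →
  (P R : Poly k) → AllMon Q₁ P → AllMon Q₂ R → AllMon Q (mulPoly P R)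
AllMon-mulPoly combine []            R []         _   = []
AllMon-mulPoly {Q₂ = Q₂} {Q} combine ((c , e) ∷ P) R (q₁ ∷ Q₁P) Q₂R =
  AllMon-++ (map (mulMonomial (c , e)) R) (mulPoly P R) (AllMon-map R Q₂R) (AllMon-mulPoly combine P R Q₁P Q₂R)
  where
  AllMon-map : ∀ R → AllMon Q₂ R → AllMon Q (map (mulMonomial (c , e)) R)
  AllMon-map []              []          = []
  AllMon-map ((c′ , e′) ∷ R) (q₂ ∷ Q₂R′) =
    (λ cc′≢0 → combine (q₁ (λ c≡0 → cc′≢0 (trans (cong (_* c′) c≡0) (QP.*-zeroˡ c′))))
                       (q₂ (λ c′≡0 → cc′≢0 (trans (cong (c *_) c′≡0) (QP.*-zeroʳ c)))))
    ∷ AllMon-map R Q₂R′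

sumFin-+ : ∀ m (e e′ : Fin m → ℕ) → sumFin m (λ i → e i ℕ.+ e′ i) ≡ sumFin m e ℕ.+ sumFin m e′
sumFin-+ zero    e e′ = refl
sumFin-+ (suc m) e e′ = trans (cong (e zero ℕ.+ e′ zero ℕ.+_) (sumFin-+ m (λ i → e (suc i)) (λ i → e′ (suc i))))
  (ℕ-+-interchange (e zero) (e′ zero) _ _)

sumFin-zeroExp : ∀ m → sumFin m (zeroExp {m}) ≡ 0
sumFin-zeroExp zero    = refl
sumFin-zeroExp (suc m) = sumFin-zeroExp m

sumFin-unitExp : ∀ m (s : Fin m) → sumFin m (unitExp s) ≡ 1
sumFin-unitExp (suc m) zero    = cong suc (sumFin-zeroExp m)
sumFin-unitExp (suc m) (suc s) = sumFin-unitExp m s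

unitExp-support : ∀ {m} (s i : Fin m) → unitExp s i ≢ 0 → i ≡ s
unitExp-support zero    zero    _   = refl
unitExp-support zero    (suc i) ≢0 = ⊥-elim (≢0 refl)
unitExp-support (suc s) zero    ≢0 = ⊥-elim (≢0 refl)
unitExp-support (suc s) (suc i) ≢0 = cong suc (unitExp-support s i ≢0)

ZetaMonomial-zeroExp : ∀ A d → ZetaMonomial A d zeroExp
ZetaMonomial-zeroExp A d = (λ s ≢0 → ⊥-elim (≢0 refl)) , subst (ℕ._≤ d) (sym (sumFin-zeroExp (suc A))) ℕ.z≤n

ZetaMonomial-+ : ∀ A d d′ {e e′} → ZetaMonomial A d e → ZetaMonomial A d′ e′ →
  ZetaMonomial A (d ℕ.+ d′) (λ i → e i ℕ.+ e′ i)
ZetaMonomial-+ A d d′ {e} {e′} (support , degree) (support′ , degree′) =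
  support″ , subst (ℕ._≤ d ℕ.+ d′) (sym (sumFin-+ (suc A) e e′)) (NP.+-mono-≤ degree degree′)
  where
  support″ : ∀ s → e s ℕ.+ e′ s ≢ 0 → (3 ℕ.≤ toℕ s) × (toℕ s ℕ.% 2 ≡ 1)
  support″ s ≢0 with e s ℕ.≟ 0
  ... | no  es≢0 = support s es≢0
  ... | yes es≡0 = support′ s (λ e′s≡0 → ≢0 (cong₂ ℕ._+_ es≡0 e′s≡0))

AllMon-prodPoly : ∀ A p (P : Fin p → Poly (suc A)) → (∀ j → AllMon (ZetaMonomial A 1) (P j)) →
  AllMon (ZetaMonomial A p) (prodPoly p P)
AllMon-prodPoly A zero    P linear = (λ _ → ZetaMonomial-zeroExp A 0) ∷ []
AllMon-prodPoly A (suc p) P linear =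
  AllMon-mulPoly (ZetaMonomial-+ A 1 p) (P zero) (prodPoly p (λ j → P (suc j)))
    (linear zero) (AllMon-prodPoly A p (λ j → P (suc j)) (λ j → linear (suc j)))

-- One variable: a linear form in zeta values

sum-coeffOfOrder : ∀ m f (G : ℕ → ℚ) → order f ℕ.< m →
  sum (λ (s : Fin m) → coeffOfOrder (toℕ s) f * G (toℕ s)) ≡ coeff f * G (order f)
sum-coeffOfOrder (suc m) (frac c i zero) G _ = begin
  c * G 0 + sum (λ (s : Fin m) → 0ℚ * G (suc (toℕ s)))  ≡⟨ cong (c * G 0 +_) (sum-cong-≗ {m} (λ s → QP.*-zeroˡ (G (suc (toℕ s))))) ⟩
  c * G 0 + sum (λ (s : Fin m) → 0ℚ)                    ≡⟨ cong (c * G 0 +_) (sum-replicate-zero m) ⟩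
  c * G 0 + 0ℚ                                          ≡⟨ QP.+-identityʳ (c * G 0) ⟩
  c * G 0 ∎
  where open ≡-Reasoning
sum-coeffOfOrder (suc m) (frac c i (suc s)) G (ℕ.s≤s s<m) = begin
  0ℚ * G 0 + sum (λ (t : Fin m) → coeffOfOrder (toℕ t) (frac c i s) * G (suc (toℕ t)))
    ≡⟨ cong₂ _+_ (QP.*-zeroˡ (G 0)) (sum-coeffOfOrder m (frac c i s) (G ∘ suc) s<m) ⟩
  0ℚ + c * G (suc s)
    ≡⟨ QP.+-identityˡ (c * G (suc s)) ⟩
  c * G (suc s) ∎
  where open ≡-Reasoning

zetaPart-regroup : ∀ A T M → All ((ℕ._≤ A) ∘ order) T →
  zetaPart T M ≡ sum (λ (s : Fin (suc A)) → totalCoeff (toℕ s) T * zetaTrunc (toℕ s) M)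
zetaPart-regroup A [] M [] = sym (trans (sum-cong-≗ {suc A} (λ s → QP.*-zeroˡ (zetaTrunc (toℕ s) M))) (sum-replicate-zero (suc A)))
zetaPart-regroup A (f ∷ T) M (s≤A ∷ T≤A) = begin
  coeff f * zetaTrunc (order f) M + zetaPart T M
    ≡⟨ cong₂ _+_ (sym (sum-coeffOfOrder (suc A) f (λ s → zetaTrunc s M) (ℕ.s≤s s≤A))) (zetaPart-regroup A T M T≤A) ⟩
  sum (λ (s : Fin (suc A)) → coeffOfOrder (toℕ s) f * zetaTrunc (toℕ s) M) + sum (λ (s : Fin (suc A)) → totalCoeff (toℕ s) T * zetaTrunc (toℕ s) M)
    ≡⟨ sym (∑-distrib-+ {suc A} (λ s → coeffOfOrder (toℕ s) f * zetaTrunc (toℕ s) M) (λ s → totalCoeff (toℕ s) T * zetaTrunc (toℕ s) M)) ⟩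
  sum (λ (s : Fin (suc A)) → coeffOfOrder (toℕ s) f * zetaTrunc (toℕ s) M + totalCoeff (toℕ s) T * zetaTrunc (toℕ s) M)
    ≡⟨ sum-cong-≗ {suc A} (λ s → sym (QP.*-distribʳ-+ (zetaTrunc (toℕ s) M) (coeffOfOrder (toℕ s) f) (totalCoeff (toℕ s) T))) ⟩
  sum (λ (s : Fin (suc A)) → (coeffOfOrder (toℕ s) f + totalCoeff (toℕ s) T) * zetaTrunc (toℕ s) M) ∎
  where open ≡-Reasoning

oddAtLeast3? : ∀ s → Dec (OddAtLeast3 s)
oddAtLeast3? s = (3 ℕ.≤? s) ×-dec (s ℕ.% 2 ℕ.≟ 1)

-- The coefficient of ζ(s), forced to 0 off odd s ≥ 3 (which loses nothing, by oddTermPF-totalCoeff).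
zetaCoeff : ℕ → ℕ → ℕ → ℕ → ℚ
zetaCoeff n A e s with oddAtLeast3? s
... | yes _ = totalCoeff s (oddTermPF n A e)
... | no  _ = 0ℚ

zetaCoeff-support : ∀ n A e s → zetaCoeff n A e s ≢ 0ℚ → OddAtLeast3 s
zetaCoeff-support n A e s ≢0 with oddAtLeast3? s
... | yes good = good
... | no  _    = ⊥-elim (≢0 refl)

totalCoeff≡zetaCoeff : ∀ n A e s → e ℕ.+ 2 ℕ.≤ A ℕ.* (n ℕ.+ 1) → totalCoeff s (oddTermPF n A e) ≡ zetaCoeff n A e s
totalCoeff≡zetaCoeff n A e s e+2≤ with oddAtLeast3? s
... | yes _   = refl
... | no  bad = oddTermPF-totalCoeff n A e s e+2≤ bad

zetaVector : ∀ A → ℕ → Fin (suc A) → ℚ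
zetaVector A M s = zetaTrunc (toℕ s) M

zetaLinear : ∀ n A → ℕ → Poly (suc A)
zetaLinear n A e = (constantPart (oddTermPF n A e) , zeroExp) ∷ tabulate (λ s → zetaCoeff n A e (toℕ s) , unitExp s)

evalPoly-zetaLinear : ∀ n A e z →
  evalPoly (zetaLinear n A e) z ≡ constantPart (oddTermPF n A e) + sum (λ s → zetaCoeff n A e (toℕ s) * z s)
evalPoly-zetaLinear n A e z = cong₂ _+_
  (trans (cong (constantPart (oddTermPF n A e) *_) (prodFinℚ-zeroExp (suc A) z)) (QP.*-identityʳ (constantPart (oddTermPF n A e))))
  (trans (evalPoly-tabulate (suc A) (λ s → zetaCoeff n A e (toℕ s) , unitExp s) z)
         (sum-cong-≗ {suc A} (λ s → cong (zetaCoeff n A e (toℕ s) *_) (prodFinℚ-unitExp (suc A) s z))))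

zetaLinear-monomials : ∀ n A e → AllMon (ZetaMonomial A 1) (zetaLinear n A e)
zetaLinear-monomials n A e = (λ _ → ZetaMonomial-zeroExp A 1) ∷
  AllMon-tabulate (suc A) (λ s → zetaCoeff n A e (toℕ s) , unitExp s) λ s ≢0 →
    (λ i ≢0′ → subst OddAtLeast3 (cong toℕ (sym (unitExp-support s i ≢0′))) (zetaCoeff-support n A e (toℕ s) ≢0)) ,
    NP.≤-reflexive (sumFin-unitExp (suc A) s)

zetaLinear-bounded : ∀ n A e → EventuallyBounded (λ M → evalPoly (zetaLinear n A e) (zetaVector A M))
zetaLinear-bounded n A e = EventuallyBounded-cong (λ M → sym (evalPoly-zetaLinear n A e (zetaVector A M)))
  (EventuallyBounded-+ (EventuallyBounded-const (constantPart (oddTermPF n A e)))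
    (sum-bounded (suc A) (λ s M → zetaCoeff n A e (toℕ s) * zetaTrunc (toℕ s) M) (λ s → term-bounded (toℕ s))))
  where
  sum-bounded : ∀ m (f : Fin m → ℕ → ℚ) → (∀ s → EventuallyBounded (f s)) → EventuallyBounded (λ M → sum (λ s → f s M))
  sum-bounded zero    f bounded = EventuallyBounded-const 0ℚ
  sum-bounded (suc m) f bounded = EventuallyBounded-+ (bounded zero) (sum-bounded m (f ∘ suc) (bounded ∘ suc))
  term-bounded : ∀ s → EventuallyBounded (λ M → zetaCoeff n A e s * zetaTrunc s M)
  term-bounded s with oddAtLeast3? s
  ... | no  _ = EventuallyBounded-cong (λ M → sym (QP.*-zeroˡ (zetaTrunc s M))) (EventuallyBounded-const 0ℚ)
  term-bounded (suc zero)    | yes (ℕ.s≤s () , _)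
  term-bounded (suc (suc s)) | yes _ =
    EventuallyBounded-* (EventuallyBounded-const (totalCoeff (suc (suc s)) (oddTermPF n A e))) (zetaTrunc-bounded s)

oddTermSum : ℕ → ℕ → ℕ → ℕ → ℚ
oddTermSum n A e M = rangeSum M (λ k → evalPF (ℕtoℚ k) (oddTermPF n A e))

oddTermSum-zetaLinear : ∀ n A e → e ℕ.+ 2 ℕ.≤ A ℕ.* (n ℕ.+ 1) →
  TendsToZero (λ M → oddTermSum n A e M - evalPoly (zetaLinear n A e) (zetaVector A M))
oddTermSum-zetaLinear n A e e+2≤ = TendsToZero-cong (λ M → sym (difference M))
  (tailPart→0 T (oddTermPF-noPolynomialPart n A e (NP.<-≤-trans (NP.m<m+n e (ℕ.s≤s ℕ.z≤n)) e+2≤)))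
  where
  T = oddTermPF n A e
  cancel : ∀ (z c t : ℚ) → z + c + t - (c + z) ≡ t
  cancel = solve-∀ ℚ-ring
  zeta : ∀ M → zetaPart T M ≡ sum (λ (s : Fin (suc A)) → zetaCoeff n A e (toℕ s) * zetaVector A M s)
  zeta M = trans (zetaPart-regroup A T M (All.map proj₂ (oddTermPF-bounds n A e)))
                 (sum-cong-≗ {suc A} (λ s → cong (_* zetaTrunc (toℕ s) M) (totalCoeff≡zetaCoeff n A e (toℕ s) e+2≤)))
  difference : ∀ M → oddTermSum n A e M - evalPoly (zetaLinear n A e) (zetaVector A M) ≡ tailPart T M
  difference M = begin
    oddTermSum n A e M - evalPoly (zetaLinear n A e) (zetaVector A M)
      ≡⟨ cong₂ _-_ (rangeSum-evalPF T M) (evalPoly-zetaLinear n A e (zetaVector A M)) ⟩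
    zetaPart T M + constantPart T + tailPart T M - (constantPart T + sum (λ s → zetaCoeff n A e (toℕ s) * zetaVector A M s))
      ≡⟨ cong (λ z → zetaPart T M + constantPart T + tailPart T M - (constantPart T + z)) (sym (zeta M)) ⟩
    zetaPart T M + constantPart T + tailPart T M - (constantPart T + zetaPart T M)
      ≡⟨ cancel (zetaPart T M) (constantPart T) (tailPart T M) ⟩
    tailPart T M ∎
    where open ≡-Reasoning

-- Several variables

prodFinℚ-linearAt : ∀ m (j : Fin m) (f g h : Fin m → ℚ) α β →
  (∀ i → i ≢ j → f i ≡ g i) → (∀ i → i ≢ j → h i ≡ g i) → f j ≡ α * g j + β * h j →
  prodFinℚ m f ≡ α * prodFinℚ m g + β * prodFinℚ m h
prodFinℚ-linearAt (suc m) zero f g h α β f≡g h≡g fj = begin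
    f zero * prodFinℚ m (f ∘ suc)
      ≡⟨ cong₂ _*_ fj (prodFinℚ-cong m (λ i → f≡g (suc i) λ ())) ⟩
    (α * g zero + β * h zero) * prodFinℚ m (g ∘ suc)
      ≡⟨ distribute α β (g zero) (h zero) (prodFinℚ m (g ∘ suc)) ⟩
    α * (g zero * prodFinℚ m (g ∘ suc)) + β * (h zero * prodFinℚ m (g ∘ suc))
      ≡⟨ cong (λ r → α * (g zero * prodFinℚ m (g ∘ suc)) + β * (h zero * r)) (sym (prodFinℚ-cong m (λ i → h≡g (suc i) λ ()))) ⟩
    α * (g zero * prodFinℚ m (g ∘ suc)) + β * (h zero * prodFinℚ m (h ∘ suc)) ∎
  where
  open ≡-Reasoning
  distribute : ∀ (α β g h G : ℚ) → (α * g + β * h) * G ≡ α * (g * G) + β * (h * G)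
  distribute = solve-∀ ℚ-ring
prodFinℚ-linearAt (suc m) (suc j) f g h α β f≡g h≡g fj = begin
    f zero * prodFinℚ m (f ∘ suc)
      ≡⟨ cong₂ _*_ (f≡g zero λ ()) (prodFinℚ-linearAt m j (f ∘ suc) (g ∘ suc) (h ∘ suc) α β
                                     (λ i i≢j → f≡g (suc i) (i≢j ∘ FP.suc-injective))
                                     (λ i i≢j → h≡g (suc i) (i≢j ∘ FP.suc-injective)) fj) ⟩
    g zero * (α * prodFinℚ m (g ∘ suc) + β * prodFinℚ m (h ∘ suc))
      ≡⟨ distribute α β (g zero) (prodFinℚ m (g ∘ suc)) (prodFinℚ m (h ∘ suc)) ⟩
    α * (g zero * prodFinℚ m (g ∘ suc)) + β * (g zero * prodFinℚ m (h ∘ suc))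
      ≡⟨ cong (λ r → α * (g zero * prodFinℚ m (g ∘ suc)) + β * (r * prodFinℚ m (h ∘ suc))) (sym (h≡g zero λ ())) ⟩
    α * (g zero * prodFinℚ m (g ∘ suc)) + β * (h zero * prodFinℚ m (h ∘ suc)) ∎
  where
  open ≡-Reasoning
  distribute : ∀ (α β g G H : ℚ) → g * (α * G + β * H) ≡ α * (g * G) + β * (g * H)
  distribute = solve-∀ ℚ-ring

boxSum-cong : ∀ p M {f g : (Fin p → ℕ) → ℚ} → (∀ k → (∀ j → 1 ℕ.≤ k j) → f k ≡ g k) → boxSum p M f ≡ boxSum p M g
boxSum-cong zero    M f≡g = f≡g (λ ()) (λ ())
boxSum-cong (suc p) M f≡g = rangeSum-cong M λ k₀ 1≤k₀ →
  boxSum-cong p M λ k 1≤k → f≡g (k₀ ∷ᵥ k) λ { zero → 1≤k₀ ; (suc j) → 1≤k j }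

boxSum-0 : ∀ p M → boxSum p M (λ _ → 0ℚ) ≡ 0ℚ
boxSum-0 zero    M = refl
boxSum-0 (suc p) M = trans (rangeSum-cong M (λ _ _ → boxSum-0 p M)) (rangeSum-0 M)

boxSum-+ : ∀ p M (f g : (Fin p → ℕ) → ℚ) → boxSum p M (λ k → f k + g k) ≡ boxSum p M f + boxSum p M g
boxSum-+ zero    M f g = refl
boxSum-+ (suc p) M f g = trans (rangeSum-cong M (λ k₀ _ → boxSum-+ p M (f ∘ (k₀ ∷ᵥ_)) (g ∘ (k₀ ∷ᵥ_))))
  (rangeSum-+ M (λ k₀ → boxSum p M (f ∘ (k₀ ∷ᵥ_))) (λ k₀ → boxSum p M (g ∘ (k₀ ∷ᵥ_))))

boxSum-scale : ∀ p M c (f : (Fin p → ℕ) → ℚ) → boxSum p M (λ k → c * f k) ≡ c * boxSum p M f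
boxSum-scale zero    M c f = refl
boxSum-scale (suc p) M c f = trans (rangeSum-cong M (λ k₀ _ → boxSum-scale p M c (f ∘ (k₀ ∷ᵥ_))))
  (rangeSum-scale M c (λ k₀ → boxSum p M (f ∘ (k₀ ∷ᵥ_))))

boxSum-prodFinℚ : ∀ p M (u : Fin p → ℕ → ℚ) →
  boxSum p M (λ k → prodFinℚ p (λ j → u j (k j))) ≡ prodFinℚ p (λ j → rangeSum M (u j))
boxSum-prodFinℚ zero    M u = refl
boxSum-prodFinℚ (suc p) M u = begin
  rangeSum M (λ k₀ → boxSum p M (λ k → u zero k₀ * prodFinℚ p (λ j → u (suc j) (k j))))
    ≡⟨ rangeSum-cong M (λ k₀ _ → trans (boxSum-scale p M (u zero k₀) (λ k → prodFinℚ p (λ j → u (suc j) (k j))))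
                                       (cong (u zero k₀ *_) (boxSum-prodFinℚ p M (u ∘ suc)))) ⟩
  rangeSum M (λ k₀ → u zero k₀ * R)
    ≡⟨ rangeSum-cong M (λ k₀ _ → QP.*-comm (u zero k₀) R) ⟩
  rangeSum M (λ k₀ → R * u zero k₀)
    ≡⟨ rangeSum-scale M R (u zero) ⟩
  R * rangeSum M (u zero)
    ≡⟨ QP.*-comm R (rangeSum M (u zero)) ⟩
  rangeSum M (u zero) * R ∎
  where
  open ≡-Reasoning
  R = prodFinℚ p (λ j → rangeSum M (u (suc j)))

prodFinℚ-bounded : ∀ p (b : Fin p → ℕ → ℚ) → (∀ j → EventuallyBounded (b j)) →
  EventuallyBounded (λ M → prodFinℚ p (λ j → b j M))
prodFinℚ-bounded zero    b bounded = EventuallyBounded-const 1ℚ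
prodFinℚ-bounded (suc p) b bounded = EventuallyBounded-* (bounded zero) (prodFinℚ-bounded p (b ∘ suc) (bounded ∘ suc))

-- ∏ aⱼ − ∏ bⱼ = (a₀ − b₀) ∏_{j>0} aⱼ + b₀ (∏_{j>0} aⱼ − ∏_{j>0} bⱼ).
prodFinℚ-difference→0 : ∀ p (a b : Fin p → ℕ → ℚ) → (∀ j → TendsToZero (λ M → a j M - b j M)) →
  (∀ j → EventuallyBounded (b j)) → TendsToZero (λ M → prodFinℚ p (λ j → a j M) - prodFinℚ p (λ j → b j M))
prodFinℚ-difference→0 zero    a b a-b→0 bounded = TendsToZero-cong (λ M → sym (QP.+-inverseʳ 1ℚ)) TendsToZero-0
prodFinℚ-difference→0 (suc p) a b a-b→0 bounded =
  TendsToZero-cong (λ M → sym (split (a zero M) (b zero M) (A′ M) (B′ M)))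
    (TendsToZero-+ (TendsToZero-*-bounded (a-b→0 zero) A′-bounded) (TendsToZero-bounded-* (bounded zero) rest→0))
  where
  A′ B′ : ℕ → ℚ
  A′ M = prodFinℚ p (λ j → a (suc j) M)
  B′ M = prodFinℚ p (λ j → b (suc j) M)
  split : ∀ (a b A B : ℚ) → a * A - b * B ≡ (a - b) * A + b * (A - B)
  split = solve-∀ ℚ-ring
  rest→0 = prodFinℚ-difference→0 p (a ∘ suc) (b ∘ suc) (a-b→0 ∘ suc) (bounded ∘ suc)
  recombine : ∀ (A B : ℚ) → B + (A - B) ≡ A
  recombine = solve-∀ ℚ-ring
  A′-bounded : EventuallyBounded A′
  A′-bounded = EventuallyBounded-cong (λ M → recombine (A′ M) (B′ M))
    (EventuallyBounded-+ (prodFinℚ-bounded p (b ∘ suc) (bounded ∘ suc)) (TendsToZero⇒EventuallyBounded rest→0))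

invℕ-pochProd : ∀ n A p (k : Fin p → ℕ) → invℕ (pochProd n A p k) ≡ prodFinℚ p (λ j → weight n A (ℕtoℚ (k j)))
invℕ-pochProd n A zero    k = refl
invℕ-pochProd n A (suc p) k = trans (invℕ-distrib-* (poch (k zero) (suc n) ℕ.^ A) (pochProd n A p (k ∘ suc)))
  (cong₂ _*_ (trans (invℕ-^ (poch (k zero) (suc n)) A) (cong (λ r → inv r ^ℚ A) (ℕtoℚ-poch (k zero) (suc n))))
             (invℕ-pochProd n A p (k ∘ suc)))

AvoidsPoles-positive : ∀ n m → 1 ℕ.≤ m → AvoidsPoles n (ℕtoℚ m)
AvoidsPoles-positive n (suc m) _ i _ m+i≡0 = ℕtoℚ[1+m]≢0 (m ℕ.+ i) (trans (ℕtoℚ-homo-+ (suc m) i) m+i≡0)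

module Multivariate (p n A : ℕ) where

  σ : ℚ
  σ = signPow (A ℕ.* (n ℕ.+ 1))

  prodWeight : (Fin p → ℚ) → ℚ
  prodWeight x = prodFinℚ p (λ j → weight n A (x j))

  prodWeight-reflect : ∀ j x → prodWeight (reflectAt n j x) ≡ σ * prodWeight x
  prodWeight-reflect j x = trans
    (prodFinℚ-linearAt p j (λ i → weight n A (reflectAt n j x i)) (λ i → weight n A (x i)) (λ i → weight n A (x i)) σ 0ℚ
      (λ i i≢j → cong (weight n A) (VFP.updateAt-minimal i j x i≢j)) (λ _ _ → refl)
      (trans (cong (weight n A) (VFP.updateAt-updates j x))
             (trans (weight-reflect n A (x j)) (sym (drop0 (σ * weight n A (x j)) (weight n A (x j)))))))
    (drop0 (σ * prodWeight x) (prodWeight x))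
    where
    drop0 : ∀ (a b : ℚ) → a + 0ℚ * b ≡ a
    drop0 = solve-∀ ℚ-ring

  Antisymmetric : Poly p → Set
  Antisymmetric P = (j : Fin p) (x : Fin p → ℚ) →
    evalPoly P (reflectAt n j x) ≡ signPow (A ℕ.* (n ℕ.+ 1) ℕ.+ 1) * evalPoly P x

  weighted-antisymmetric : ∀ P → Antisymmetric P → ∀ j x →
    evalPoly P (reflectAt n j x) * prodWeight (reflectAt n j x) ≡ - (evalPoly P x * prodWeight x)
  weighted-antisymmetric P antisym j x = begin
    evalPoly P (reflectAt n j x) * prodWeight (reflectAt n j x)
      ≡⟨ cong₂ _*_ (trans (antisym j x) (cong (_* evalPoly P x) (signPow-+ (A ℕ.* (n ℕ.+ 1)) 1))) (prodWeight-reflect j x) ⟩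
    (σ * (- 1ℚ) * evalPoly P x) * (σ * prodWeight x)
      ≡⟨ regroup σ (evalPoly P x) (prodWeight x) ⟩
    - ((σ * σ) * (evalPoly P x * prodWeight x))
      ≡⟨ cong (λ t → - (t * (evalPoly P x * prodWeight x))) (signPow-square (A ℕ.* (n ℕ.+ 1))) ⟩
    - (1ℚ * (evalPoly P x * prodWeight x))
      ≡⟨ cong -_ (QP.*-identityˡ _) ⟩
    - (evalPoly P x * prodWeight x) ∎
    where
    open ≡-Reasoning
    regroup : ∀ (σ P w : ℚ) → (σ * (- 1ℚ) * P) * (σ * w) ≡ - ((σ * σ) * (P * w))
    regroup = solve-∀ ℚ-ring

  oddPartIf : Bool → ℕ → ℚ → ℚ
  oddPartIf false e y = term n A e y
  oddPartIf true  e y = Q.½ * (term n A e y - term n A e (- y - ℕtoℚ n))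

  -- P(x) ∏ weight(xⱼ) expanded monomial by monomial, each factor replaced by its odd part where u is true.
  expansion : (Fin p → Bool) → Poly p → (Fin p → ℚ) → ℚ
  expansion u []            x = 0ℚ
  expansion u ((c , e) ∷ R) x = c * prodFinℚ p (λ j → oddPartIf (u j) (e j) (x j)) + expansion u R x

  expansion-none : ∀ R x → expansion (λ _ → false) R x ≡ evalPoly R x * prodWeight x
  expansion-none []            x = sym (QP.*-zeroˡ (prodWeight x))
  expansion-none ((c , e) ∷ R) x = begin
    c * prodFinℚ p (λ j → term n A (e j) (x j)) + expansion (λ _ → false) R x
      ≡⟨ cong₂ _+_ (cong (c *_) (prodFinℚ-* p (λ j → x j ^ℚ e j) (λ j → weight n A (x j)))) (expansion-none R x) ⟩
    c * (prodFinℚ p (λ j → x j ^ℚ e j) * prodWeight x) + evalPoly R x * prodWeight x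
      ≡⟨ factor c (prodFinℚ p (λ j → x j ^ℚ e j)) (prodWeight x) (evalPoly R x) ⟩
    (c * prodFinℚ p (λ j → x j ^ℚ e j) + evalPoly R x) * prodWeight x ∎
    where
    open ≡-Reasoning
    factor : ∀ (c a w b : ℚ) → c * (a * w) + b * w ≡ (c * a + b) * w
    factor = solve-∀ ℚ-ring

  expansion-cong : ∀ {u u′} → (∀ i → u i ≡ u′ i) → ∀ R x → expansion u R x ≡ expansion u′ R x
  expansion-cong u≡u′ []            x = refl
  expansion-cong u≡u′ ((c , e) ∷ R) x = cong₂ _+_
    (cong (c *_) (prodFinℚ-cong p (λ j → cong (λ b → oddPartIf b (e j) (x j)) (u≡u′ j)))) (expansion-cong u≡u′ R x)

  expansion-flip : ∀ (u u′ : Fin p → Bool) j R x → u j ≡ false → u′ j ≡ true → (∀ i → i ≢ j → u′ i ≡ u i) →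
    expansion u′ R x ≡ Q.½ * (expansion u R x - expansion u R (reflectAt n j x))
  expansion-flip u u′ j []            x _   _    _      = sym (QP.*-zeroʳ Q.½)
  expansion-flip u u′ j ((c , e) ∷ R) x u≡f u′≡t u′≡u = begin
      c * prodFinℚ p f + expansion u′ R x
        ≡⟨ cong₂ _+_ (cong (c *_) linear) (expansion-flip u u′ j R x u≡f u′≡t u′≡u) ⟩
      c * (Q.½ * prodFinℚ p g + (- Q.½) * prodFinℚ p h) + Q.½ * (expansion u R x - expansion u R (reflectAt n j x))
        ≡⟨ collect c (prodFinℚ p g) (prodFinℚ p h) (expansion u R x) (expansion u R (reflectAt n j x)) ⟩
      Q.½ * ((c * prodFinℚ p g + expansion u R x) - (c * prodFinℚ p h + expansion u R (reflectAt n j x))) ∎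
    where
    open ≡-Reasoning
    f g h : Fin p → ℚ
    f i = oddPartIf (u′ i) (e i) (x i)
    g i = oddPartIf (u i) (e i) (x i)
    h i = oddPartIf (u i) (e i) (reflectAt n j x i)
    halve : ∀ (a b : ℚ) → Q.½ * (a - b) ≡ Q.½ * a + (- Q.½) * b
    halve = solve-∀ ℚ-ring
    collect : ∀ (c G H R₁ R₂ : ℚ) →
      c * (Q.½ * G + (- Q.½) * H) + Q.½ * (R₁ - R₂) ≡ Q.½ * ((c * G + R₁) - (c * H + R₂))
    collect = solve-∀ ℚ-ring
    fj : f j ≡ Q.½ * g j + (- Q.½) * h j
    fj = begin
      oddPartIf (u′ j) (e j) (x j)
        ≡⟨ cong (λ b → oddPartIf b (e j) (x j)) u′≡t ⟩
      Q.½ * (term n A (e j) (x j) - term n A (e j) (- x j - ℕtoℚ n))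
        ≡⟨ cong (λ y → Q.½ * (term n A (e j) (x j) - term n A (e j) y)) (sym (VFP.updateAt-updates j x)) ⟩
      Q.½ * (term n A (e j) (x j) - term n A (e j) (reflectAt n j x j))
        ≡⟨ halve (term n A (e j) (x j)) (term n A (e j) (reflectAt n j x j)) ⟩
      Q.½ * term n A (e j) (x j) + (- Q.½) * term n A (e j) (reflectAt n j x j)
        ≡⟨ sym (cong₂ (λ a b → Q.½ * oddPartIf a (e j) (x j) + (- Q.½) * oddPartIf b (e j) (reflectAt n j x j)) u≡f u≡f) ⟩
      Q.½ * g j + (- Q.½) * h j ∎
    linear : prodFinℚ p f ≡ Q.½ * prodFinℚ p g + (- Q.½) * prodFinℚ p h
    linear = prodFinℚ-linearAt p j f g h Q.½ (- Q.½)
      (λ i i≢j → cong (λ b → oddPartIf b (e i) (x i)) (u′≡u i i≢j))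
      (λ i i≢j → cong (oddPartIf (u i) (e i)) (VFP.updateAt-minimal i j x i≢j)) fj

  -- Flip the variables to odd parts one at a time; each flip is harmless by antisymmetry.
  expansion-all : ∀ P → Antisymmetric P → ∀ x → expansion (λ _ → true) P x ≡ evalPoly P x * prodWeight x
  expansion-all P antisym x =
    trans (expansion-cong (λ i → sym (below (toℕ i) p (FP.toℕ<n i))) P x) (firsts p NP.≤-refl x)
    where
    below : ∀ a m → a ℕ.< m → (a ℕ.<ᵇ m) ≡ true
    below zero    (suc m) _           = refl
    below (suc a) (suc m) (ℕ.s≤s a<m) = below a m a<m
    irrefl : ∀ m → (m ℕ.<ᵇ m) ≡ false
    irrefl zero    = refl
    irrefl (suc m) = irrefl m
    step : ∀ m → (m ℕ.<ᵇ suc m) ≡ true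
    step m = below m (suc m) NP.≤-refl
    other : ∀ a m → a ≢ m → (a ℕ.<ᵇ suc m) ≡ (a ℕ.<ᵇ m)
    other zero    zero    a≢m = ⊥-elim (a≢m refl)
    other zero    (suc m) _   = refl
    other (suc a) zero    _   = refl
    other (suc a) (suc m) a≢m = other a m (a≢m ∘ cong suc)
    firsts : ∀ m → m ℕ.≤ p → ∀ x → expansion (λ i → toℕ i ℕ.<ᵇ m) P x ≡ evalPoly P x * prodWeight x
    firsts zero    _     x = expansion-none P x
    firsts (suc m) m<p x = begin
        expansion (λ i → toℕ i ℕ.<ᵇ suc m) P x
          ≡⟨ expansion-flip (λ i → toℕ i ℕ.<ᵇ m) (λ i → toℕ i ℕ.<ᵇ suc m) j P x
               (trans (cong (ℕ._<ᵇ m) toℕj≡m) (irrefl m)) (trans (cong (ℕ._<ᵇ suc m) toℕj≡m) (step m))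
               (λ i i≢j → other (toℕ i) m (λ i≡m → i≢j (FP.toℕ-injective (trans i≡m (sym toℕj≡m))))) ⟩
        Q.½ * (expansion (λ i → toℕ i ℕ.<ᵇ m) P x - expansion (λ i → toℕ i ℕ.<ᵇ m) P (reflectAt n j x))
          ≡⟨ cong₂ (λ a b → Q.½ * (a - b)) (firsts m (NP.<⇒≤ m<p) x) (firsts m (NP.<⇒≤ m<p) (reflectAt n j x)) ⟩
        Q.½ * (evalPoly P x * prodWeight x - evalPoly P (reflectAt n j x) * prodWeight (reflectAt n j x))
          ≡⟨ cong (λ t → Q.½ * (evalPoly P x * prodWeight x - t)) (weighted-antisymmetric P antisym j x) ⟩
        Q.½ * (evalPoly P x * prodWeight x - - (evalPoly P x * prodWeight x))
          ≡⟨ half-double (evalPoly P x * prodWeight x) ⟩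
        evalPoly P x * prodWeight x ∎
      where
      open ≡-Reasoning
      j = fromℕ< m<p
      toℕj≡m = FP.toℕ-fromℕ< m<p
      half-double : ∀ (F : ℚ) → Q.½ * (F - - F) ≡ F
      half-double = solve-∀ ℚ-ring

  BelowDegree : (Fin p → ℕ) → Set
  BelowDegree e = (i : Fin p) → e i ℕ.+ 2 ℕ.≤ A ℕ.* (n ℕ.+ 1)

  oddSummand : Poly p → (Fin p → ℕ) → ℚ
  oddSummand []            k = 0ℚ
  oddSummand ((c , e) ∷ R) k = c * prodFinℚ p (λ j → evalPF (ℕtoℚ (k j)) (oddTermPF n A (e j))) + oddSummand R k

  expansion≡oddSummand : ∀ R → AllMon BelowDegree R → ∀ k → (∀ j → 1 ℕ.≤ k j) →
    expansion (λ _ → true) R (ℕtoℚ ∘ k) ≡ oddSummand R k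
  expansion≡oddSummand []            []          k 1≤k = refl
  expansion≡oddSummand ((c , e) ∷ R) (below ∷ bs) k 1≤k = cong₂ _+_ monomial (expansion≡oddSummand R bs k 1≤k)
    where
    monomial : c * prodFinℚ p (λ j → oddPartIf true (e j) (ℕtoℚ (k j)))
             ≡ c * prodFinℚ p (λ j → evalPF (ℕtoℚ (k j)) (oddTermPF n A (e j)))
    monomial with ≡0⊎≢0 c
    ... | inj₁ refl = trans (QP.*-zeroˡ (prodFinℚ p (λ j → oddPartIf true (e j) (ℕtoℚ (k j)))))
                            (sym (QP.*-zeroˡ (prodFinℚ p (λ j → evalPF (ℕtoℚ (k j)) (oddTermPF n A (e j))))))
    ... | inj₂ c≢0  = cong (c *_) (prodFinℚ-cong p λ j → sym
      (evalPF-oddTermPF n A (e j) (ℕtoℚ (k j)) (AvoidsPoles-positive n (k j) (1≤k j))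
                        (NP.≤-trans (NP.m≤m+n (e j) 2) (below c≢0 j))))

  oddSeries : Poly p → ℕ → ℚ
  oddSeries []            M = 0ℚ
  oddSeries ((c , e) ∷ R) M = c * prodFinℚ p (λ j → oddTermSum n A (e j) M) + oddSeries R M

  boxSum-oddSummand : ∀ R M → boxSum p M (oddSummand R) ≡ oddSeries R M
  boxSum-oddSummand []            M = boxSum-0 p M
  boxSum-oddSummand ((c , e) ∷ R) M = begin
    boxSum p M (λ k → c * summand k + oddSummand R k)
      ≡⟨ boxSum-+ p M (λ k → c * summand k) (oddSummand R) ⟩
    boxSum p M (λ k → c * summand k) + boxSum p M (oddSummand R)
      ≡⟨ cong₂ _+_ (trans (boxSum-scale p M c summand)
                          (cong (c *_) (boxSum-prodFinℚ p M (λ j k → evalPF (ℕtoℚ k) (oddTermPF n A (e j))))))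
                   (boxSum-oddSummand R M) ⟩
    c * prodFinℚ p (λ j → oddTermSum n A (e j) M) + oddSeries R M ∎
    where
    open ≡-Reasoning
    summand : (Fin p → ℕ) → ℚ
    summand k = prodFinℚ p (λ j → evalPF (ℕtoℚ (k j)) (oddTermPF n A (e j)))

  seriesPartial≡oddSeries : ∀ P → AllMon BelowDegree P → Antisymmetric P → ∀ M → seriesPartial p n A P M ≡ oddSeries P M
  seriesPartial≡oddSeries P below antisym M = trans
    (boxSum-cong p M λ k 1≤k → begin
      evalPoly P (ℕtoℚ ∘ k) * invℕ (pochProd n A p k)     ≡⟨ cong (evalPoly P (ℕtoℚ ∘ k) *_) (invℕ-pochProd n A p k) ⟩
      evalPoly P (ℕtoℚ ∘ k) * prodWeight (ℕtoℚ ∘ k)       ≡⟨ sym (expansion-all P antisym (ℕtoℚ ∘ k)) ⟩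
      expansion (λ _ → true) P (ℕtoℚ ∘ k)                ≡⟨ expansion≡oddSummand P below k 1≤k ⟩
      oddSummand P k ∎)
    (boxSum-oddSummand P M)
    where open ≡-Reasoning

  zetaPolynomial : Poly p → Poly (suc A)
  zetaPolynomial []            = []
  zetaPolynomial ((c , e) ∷ R) = mulPoly ((c , zeroExp) ∷ []) (prodPoly p (zetaLinear n A ∘ e)) ++ zetaPolynomial R

  zetaValue : Poly p → (Fin (suc A) → ℚ) → ℚ
  zetaValue []            z = 0ℚ
  zetaValue ((c , e) ∷ R) z = c * prodFinℚ p (λ j → evalPoly (zetaLinear n A (e j)) z) + zetaValue R z

  evalPoly-zetaPolynomial : ∀ R z → evalPoly (zetaPolynomial R) z ≡ zetaValue R z
  evalPoly-zetaPolynomial []            z = refl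
  evalPoly-zetaPolynomial ((c , e) ∷ R) z = begin
    evalPoly (mulPoly constant product ++ zetaPolynomial R) z
      ≡⟨ evalPoly-++ (mulPoly constant product) (zetaPolynomial R) z ⟩
    evalPoly (mulPoly constant product) z + evalPoly (zetaPolynomial R) z
      ≡⟨ cong₂ _+_ (evalPoly-mulPoly constant product z) (evalPoly-zetaPolynomial R z) ⟩
    evalPoly constant z * evalPoly product z + zetaValue R z
      ≡⟨ cong₂ (λ a b → a * b + zetaValue R z) evalPoly-constant (evalPoly-prodPoly p (zetaLinear n A ∘ e) z) ⟩
    c * prodFinℚ p (λ j → evalPoly (zetaLinear n A (e j)) z) + zetaValue R z ∎
    where
    open ≡-Reasoning
    constant = (c , zeroExp) ∷ []
    product = prodPoly p (zetaLinear n A ∘ e)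
    evalPoly-constant : evalPoly constant z ≡ c
    evalPoly-constant = trans (QP.+-identityʳ _) (trans (cong (c *_) (prodFinℚ-zeroExp (suc A) z)) (QP.*-identityʳ c))

  zetaPolynomial-monomials : ∀ R → AllMon (ZetaMonomial A p) (zetaPolynomial R)
  zetaPolynomial-monomials []            = []
  zetaPolynomial-monomials ((c , e) ∷ R) = AllMon-++ (mulPoly ((c , zeroExp) ∷ []) (prodPoly p (zetaLinear n A ∘ e))) _
    (AllMon-mulPoly (ZetaMonomial-+ A 0 p) ((c , zeroExp) ∷ []) (prodPoly p (zetaLinear n A ∘ e))
       ((λ _ → ZetaMonomial-zeroExp A 0) ∷ []) (AllMon-prodPoly A p (zetaLinear n A ∘ e) (zetaLinear-monomials n A ∘ e)))
    (zetaPolynomial-monomials R)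

  oddSeries-zetaValue→0 : ∀ R → AllMon BelowDegree R → TendsToZero (λ M → oddSeries R M - zetaValue R (zetaVector A M))
  oddSeries-zetaValue→0 []            []           = TendsToZero-cong (λ M → sym (QP.+-inverseʳ 0ℚ)) TendsToZero-0
  oddSeries-zetaValue→0 ((c , e) ∷ R) (below ∷ bs) =
    TendsToZero-cong (λ M → sym (regroup c _ _ (oddSeries R M) (zetaValue R (zetaVector A M))))
      (TendsToZero-+ monomial→0 (oddSeries-zetaValue→0 R bs))
    where
    regroup : ∀ (c a b S L : ℚ) → (c * a + S) - (c * b + L) ≡ c * (a - b) + (S - L)
    regroup = solve-∀ ℚ-ring
    difference : ℕ → ℚ
    difference M = prodFinℚ p (λ j → oddTermSum n A (e j) M) - prodFinℚ p (λ j → evalPoly (zetaLinear n A (e j)) (zetaVector A M))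
    monomial→0 : TendsToZero (λ M → c * difference M)
    monomial→0 with ≡0⊎≢0 c
    ... | inj₁ refl = TendsToZero-cong (λ M → sym (QP.*-zeroˡ (difference M))) TendsToZero-0
    ... | inj₂ c≢0  = TendsToZero-scale c (prodFinℚ-difference→0 p
      (λ j → oddTermSum n A (e j)) (λ j M → evalPoly (zetaLinear n A (e j)) (zetaVector A M))
      (λ j → oddTermSum-zetaLinear n A (e j) (below c≢0 j)) (λ j → zetaLinear-bounded n A (e j)))

mainTheorem1 : (p n A : ℕ) → 1 ℕ.≤ p → 1 ℕ.≤ A → (P : Poly p) →
    AllMon (λ e → (i : Fin p) → e i ℕ.+ 2 ℕ.≤ A ℕ.* (n ℕ.+ 1)) P →
    ((j : Fin p) (x : Fin p → ℚ) →
      evalPoly P (reflectAt n j x) ≡ signPow (A ℕ.* (n ℕ.+ 1) ℕ.+ 1) * evalPoly P x) →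
    Σ (Poly (suc A)) (λ Q → AllMon (ZetaMonomial A p) Q ×
      ((ε : ℚ) → 0ℚ < ε → ∃ (λ N → (M : ℕ) → N ℕ.≤ M →
        ∣ seriesPartial p n A P M - evalPoly Q (λ s → zetaTrunc (toℕ s) M) ∣ < ε)))
mainTheorem1 p n A _ _ P below antisym = zetaPolynomial P , zetaPolynomial-monomials P ,
  TendsToZero-cong (λ M → sym (cong₂ _-_ (seriesPartial≡oddSeries P below antisym M)
                                          (evalPoly-zetaPolynomial P (zetaVector A M))))
                   (oddSeries-zetaValue→0 P below)
  where open Multivariate p n A
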